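{- For every integer $m\ge 0$, the number of $(102,000)$-avoiding inversion sequences $e$ (of any length) with $\operatorname{dist}(e)=m$ equals $$\frac{1}{2m+1}\binom{4m+2}{m}.$$
   Context: An inversion sequence of length $n$ is an integer sequence $e=(e_1,\dots,e_n)$ with $0\le e_j\le j-1$ for all $j$. It is $(102,000)$-avoiding if there are no indices $i<j<k$ with $e_j<e_i<e_k$ and no indices $i<j<k$ with $e_i=e_j=e_k$. $\operatorname{dist}(e)$ is the number of distinct entries of $e$. By convention the empty sequence (length $0$) is included, with $\operatorname{dist}=0$. -}

module Defs where

open import Data.Nat using (ℕ; _≤_; _<_)
open import Data.Nat.Properties using (_≟_)
open import Data.Fin using (Fin; toℕ)
open import Data.List using (List; length; lookup; deduplicate)
open import Data.Product using (Σ; _×_)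
open import Relation.Binary.PropositionalEquality using (_≡_)
open import Relation.Nullary using (¬_)

-- A finite integer sequence e = (e_1,...,e_n) is represented as a list;
-- position j (0-based Fin index) corresponds to e_{j+1}.

-- Inversion sequence: 0 ≤ e_j ≤ j-1 (1-based), i.e. entry at 0-based index j is ≤ j.
IsInversionSequence : List ℕ → Set
IsInversionSequence e = (j : Fin (length e)) → lookup e j ≤ toℕ j

Contains102 : List ℕ → Set
Contains102 e = Σ (Fin (length e)) λ i → Σ (Fin (length e)) λ j → Σ (Fin (length e)) λ k →
  (toℕ i < toℕ j) × (toℕ j < toℕ k) × (lookup e j < lookup e i) × (lookup e i < lookup e k)

Contains000 : List ℕ → Set
Contains000 e = Σ (Fin (length e)) λ i → Σ (Fin (length e)) λ j → Σ (Fin (length e)) λ k →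
  (toℕ i < toℕ j) × (toℕ j < toℕ k) × (lookup e i ≡ lookup e j) × (lookup e j ≡ lookup e k)

Avoids102-000 : List ℕ → Set
Avoids102-000 e = ¬ Contains102 e × ¬ Contains000 e

dist : List ℕ → ℕ
dist e = length (deduplicate _≟_ e)

Counted : ℕ → List ℕ → Set
Counted m e = IsInversionSequence e × Avoids102-000 e × (dist e ≡ m)

{-# OPTIONS --safe #-}
-- Deleting every copy of the largest entry M of a (102,000)-avoiding inversion sequence E
-- with m + 1 distinct entries leaves such a sequence e with m distinct entries; M occurs at
-- most twice, the other entries before its last copy increase weakly (else two of them
-- would form a 102 with M), and its first copy sits at a position ≥ M.  Conversely, let t be
-- one more than the maximum of e, r the length of the longest weakly increasing prefix of e,
-- and give e the label ℓ = r + 1 − t.  The ways of inserting a new maximum into e correspond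
-- to the triples 1 ≤ a ≤ u ≤ s ≤ ℓ (one copy if s = ℓ, else two) and the pairs 1 ≤ a ≤ u ≤ ℓ
-- (two adjacent copies), and the child has label a, respectively a + 1.  In the resulting
-- generating tree with root label 1, depth m carries raney (m − i) (3i + 1) labels i + 1,
-- where raney n r = r/(4n + r) · C(4n + r, n), hence raney m 2 nodes in total.
module Submission where

open import Data.Nat
open import Data.Nat.Combinatorics using (_C_; nC1≡n; nCk+nC[k+1]≡[n+1]C[k+1])
open import Data.Nat.Properties
open import Data.Nat.Tactic.RingSolver using (solve; solve-∀)
open import Data.List.Base using (_∷_; [])
open import Relation.Binary.PropositionalEquality hiding ([_])

-- Raney numbers

raney : ℕ → ℕ → ℕ
raney zero    r       = 1
raney (suc n) zero    = 0
raney (suc n) (suc r) = raney (suc n) r + raney n (r + 4)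

pascal : ∀ n k → suc n C suc k ≡ n C k + n C suc k
pascal n k = sym (nCk+nC[k+1]≡[n+1]C[k+1] n k)

[k+1]*[n+1]C[k+1]≡[n+1]*nCk : ∀ n k → suc k * (suc n C suc k) ≡ suc n * (n C k)
[k+1]*[n+1]C[k+1]≡[n+1]*nCk zero    zero    = refl
[k+1]*[n+1]C[k+1]≡[n+1]*nCk zero    (suc k) = *-zeroʳ (2 + k)
[k+1]*[n+1]C[k+1]≡[n+1]*nCk (suc n) zero    =
  trans (+-identityʳ _) (trans (nC1≡n (2 + n)) (sym (*-identityʳ (2 + n))))
[k+1]*[n+1]C[k+1]≡[n+1]*nCk (suc n) (suc k) = begin
  (2 + k) * (suc (suc n) C suc (suc k))
    ≡⟨ cong ((2 + k) *_) (pascal (suc n) (suc k)) ⟩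
  (2 + k) * (suc n C suc k + suc n C suc (suc k))
    ≡⟨ *-distribˡ-+ (2 + k) (suc n C suc k) _ ⟩
  (2 + k) * (suc n C suc k) + (2 + k) * (suc n C suc (suc k))
    ≡⟨ cong₂ (λ x y → suc n C suc k + x + y)
      ([k+1]*[n+1]C[k+1]≡[n+1]*nCk n k)
      ([k+1]*[n+1]C[k+1]≡[n+1]*nCk n (suc k)) ⟩
  suc n C suc k + suc n * (n C k) + suc n * (n C suc k)
    ≡⟨ +-assoc (suc n C suc k) _ _ ⟩
  suc n C suc k + (suc n * (n C k) + suc n * (n C suc k))
    ≡⟨ cong (suc n C suc k +_) (*-distribˡ-+ (suc n) (n C k) _) ⟨
  suc n C suc k + suc n * (n C k + n C suc k)
    ≡⟨ cong (λ x → suc n C suc k + suc n * x) (pascal n k) ⟨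
  (2 + n) * (suc n C suc k) ∎
  where open ≡-Reasoning

[k+1]*[k+d]C[k+1]≡d*[k+d]Ck : ∀ k d → suc k * ((k + d) C suc k) ≡ d * ((k + d) C k)
[k+1]*[k+d]C[k+1]≡d*[k+d]Ck k d = +-cancelʳ-≡ (suc k * X) _ _ (begin
  suc k * ((k + d) C suc k) + suc k * X    ≡⟨ *-distribˡ-+ (suc k) _ X ⟨
  suc k * ((k + d) C suc k + X)            ≡⟨ cong (suc k *_) (+-comm _ X) ⟩
  suc k * (X + (k + d) C suc k)            ≡⟨ cong (suc k *_) (pascal (k + d) k) ⟨
  suc k * (suc (k + d) C suc k)            ≡⟨ [k+1]*[n+1]C[k+1]≡[n+1]*nCk (k + d) k ⟩
  suc (k + d) * X                          ≡⟨ cong (_* X) (+-comm d (suc k)) ⟨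
  (d + suc k) * X                          ≡⟨ *-distribʳ-+ X d (suc k) ⟩
  d * X + suc k * X                        ∎)
  where
  open ≡-Reasoning
  X = (k + d) C k

raney-step : ∀ n r a X K K′ Y Z → a ≡ 4 * n + r + 4 →
             suc n * K ≡ (3 * n + r + 4) * X → suc n * K′ ≡ suc a * X →
             a * Y ≡ r * K → a * Z ≡ (r + 4) * X → suc a * (Y + Z) ≡ suc r * K′
raney-step n r a X K K′ Y Z a≡ [n+1]K≡ [n+1]K′≡ aY≡ aZ≡ = *-cancelˡ-≡ _ _ (a * suc n) {{a*[n+1]≢0}} (begin
  a * suc n * (suc a * (Y + Z))
    ≡⟨ solve (a ∷ n ∷ Y ∷ Z ∷ []) ⟩
  suc a * (suc n * (a * Y) + suc n * (a * Z))
    ≡⟨ cong₂ (λ y z → suc a * (suc n * y + suc n * z)) aY≡ aZ≡ ⟩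
  suc a * (suc n * (r * K) + suc n * ((r + 4) * X))
    ≡⟨ solve (a ∷ n ∷ r ∷ K ∷ X ∷ []) ⟩
  suc a * (r * (suc n * K) + suc n * (r + 4) * X)
    ≡⟨ cong (λ y → suc a * (r * y + suc n * (r + 4) * X)) [n+1]K≡ ⟩
  suc a * (r * ((3 * n + r + 4) * X) + suc n * (r + 4) * X)
    ≡⟨ solve (a ∷ n ∷ r ∷ X ∷ []) ⟩
  suc a * ((4 * n + r + 4) * suc r * X)
    ≡⟨ cong (λ b → suc a * (b * suc r * X)) a≡ ⟨
  suc a * (a * suc r * X)
    ≡⟨ solve (a ∷ r ∷ X ∷ []) ⟩
  a * suc r * (suc a * X)
    ≡⟨ cong (a * suc r *_) [n+1]K′≡ ⟨
  a * suc r * (suc n * K′)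
    ≡⟨ solve (a ∷ n ∷ r ∷ K′ ∷ []) ⟩
  a * suc n * (suc r * K′) ∎)
  where
  open ≡-Reasoning
  a*[n+1]≢0 : NonZero (a * suc n)
  a*[n+1]≢0 = m*n≢0 a (suc n) {{≢-nonZero (λ a≡0 → 0≢1+n (trans (sym a≡0) (trans a≡ (+-comm _ 4))))}}

raney-closedForm : ∀ n r → (4 * n + r) * raney n r ≡ r * ((4 * n + r) C n)
raney-closedForm zero    r       = trans (*-identityʳ r) (sym (*-identityʳ r))
raney-closedForm (suc n) zero    = *-zeroʳ (4 * suc n + 0)
raney-closedForm (suc n) (suc r) =
  subst (λ b → b * raney (suc n) (suc r) ≡ suc r * (b C suc n)) (sym 4[n+1]+[r+1]≡a+1)
    (raney-step n r a (a C n) (a C suc n) (suc a C suc n) _ _ refl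
      (subst (λ b → suc n * (b C suc n) ≡ (3 * n + r + 4) * (b C n)) n+[3n+r+4]≡a
        ([k+1]*[k+d]C[k+1]≡d*[k+d]Ck n (3 * n + r + 4)))
      ([k+1]*[n+1]C[k+1]≡[n+1]*nCk a n)
      (subst (λ b → b * raney (suc n) r ≡ r * (b C suc n)) 4[n+1]+r≡a (raney-closedForm (suc n) r))
      (subst (λ b → b * raney n (r + 4) ≡ (r + 4) * (b C n)) 4n+[r+4]≡a (raney-closedForm n (r + 4))))
  where
  a = 4 * n + r + 4
  4[n+1]+[r+1]≡a+1 : 4 * suc n + suc r ≡ suc (4 * n + r + 4)
  4[n+1]+[r+1]≡a+1 = solve (n ∷ r ∷ [])
  4[n+1]+r≡a : 4 * suc n + r ≡ 4 * n + r + 4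
  4[n+1]+r≡a = solve (n ∷ r ∷ [])
  4n+[r+4]≡a : 4 * n + (r + 4) ≡ 4 * n + r + 4
  4n+[r+4]≡a = solve (n ∷ r ∷ [])
  n+[3n+r+4]≡a : n + (3 * n + r + 4) ≡ 4 * n + r + 4
  n+[3n+r+4]≡a = solve (n ∷ r ∷ [])

raney-closedForm-2 : ∀ m → (2 * m + 1) * raney m 2 ≡ (4 * m + 2) C m
raney-closedForm-2 m = *-cancelˡ-≡ _ _ 2 (begin
  2 * ((2 * m + 1) * raney m 2)     ≡⟨ *-assoc 2 (2 * m + 1) _ ⟨
  2 * (2 * m + 1) * raney m 2       ≡⟨ cong (_* raney m 2) (*-distribˡ-+ 2 (2 * m) 1) ⟩
  (2 * (2 * m) + 2) * raney m 2     ≡⟨ cong (λ b → (b + 2) * raney m 2) (*-assoc 2 2 m) ⟨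
  (4 * m + 2) * raney m 2           ≡⟨ raney-closedForm m 2 ⟩
  2 * ((4 * m + 2) C m)             ∎)
  where open ≡-Reasoning

-- Imported only now: with the constructors of All in scope, the variable lists
-- passed to solve above become ambiguous and slow checking down drastically.
open import Algebra.Properties.CommutativeSemigroup +-commutativeSemigroup using (interchange; x∙yz≈y∙xz)
open import Data.Fin using (Fin; zero; suc; toℕ)
open import Data.List.Base
  using (List; []; _∷_; [_]; _++_; map; concat; concatMap; length; lookup; take; drop; applyDownFrom)
open import Data.List.Extrema ≤-totalOrder using (max; max≤v⁺; xs≤max; ⊥≤max; argmax-sel)
open import Data.List.Membership.DecPropositional _≟_ using (_∈?_)
open import Data.List.Membership.Propositional using (_∈_; _∉_; find; lose)
open import Data.List.Membership.Propositional.Properties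
  using (∈-lookup; ∈-map⁺; ∈-map⁻; ∈-++⁺ˡ; ∈-++⁺ʳ; ∈-++⁻; ∈-concatMap⁺; ∈-concatMap⁻;
         ∈-applyDownFrom⁺; ∈-applyDownFrom⁻; ∈-deduplicate⁺; ∈-deduplicate⁻)
open import Data.List.Membership.Propositional.Properties.WithK using (unique∧set⇒bag)
open import Data.List.Properties
  using (++-assoc; length-++; length-map; length-take; take++drop≡id; filter-all; ∷-injectiveˡ; ∷-injectiveʳ;
         map-++; map-∘; map-id; map-cong-local; map-concatMap; concatMap-map; concatMap-++; concatMap-cong)
open import Data.List.Relation.Binary.BagAndSetEquality using (∼bag⇒↭)
open import Data.List.Relation.Binary.Permutation.Propositional as ↭ using (_↭_; ↭-sym)
open import Data.List.Relation.Binary.Permutation.Propositional.Properties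
  using (↭-length; ∈-resp-↭; All-resp-↭; shift)
open import Data.List.Relation.Unary.All as All using (All; []; _∷_)
import Data.List.Relation.Unary.All.Properties as All
open import Data.List.Relation.Unary.AllPairs as AllPairs using (AllPairs; []; _∷_)
import Data.List.Relation.Unary.AllPairs.Properties as AllPairs
open import Data.List.Relation.Unary.Any using (here; there)
open import Data.List.Relation.Unary.Unique.DecPropositional.Properties _≟_ using (deduplicate-!)
open import Data.List.Relation.Unary.Unique.Propositional using (Unique)
import Data.List.Relation.Unary.Unique.Propositional.Properties as Unique
open import Data.Maybe using (Maybe; nothing; just)
open import Data.Product using (Σ; _×_; _,_; proj₁; proj₂; map₂)
open import Data.Sum using (inj₁; inj₂)
open import Data.Unit using (⊤; tt)
open import Function using (_∘_; _∘′_)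
open import Function.Bundles using (_⇔_; mk⇔; Equivalence)
open import Relation.Nullary using (¬_; yes; no; ¬?; contradiction)
open import Defs

concatMap-concatMap : ∀ {A B C : Set} (f : B → List C) (g : A → List B) xs →
                      concatMap f (concatMap g xs) ≡ concatMap (concatMap f ∘′ g) xs
concatMap-concatMap f g []       = refl
concatMap-concatMap f g (x ∷ xs) =
  trans (concatMap-++ f (g x) (concatMap g xs)) (cong (concatMap f (g x) ++_) (concatMap-concatMap f g xs))

concatMap-Unique : ∀ {A B : Set} (f : A → List B) {xs} → (∀ x → Unique (f x)) →
                   (∀ {x y z} → z ∈ f x → z ∈ f y → x ≡ y) → Unique xs → Unique (concatMap f xs)
concatMap-Unique f f-unique separated xs-unique = Unique.concat⁺
  (All.map⁺ (All.tabulate (λ {x} _ → f-unique x)))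
  (AllPairs.map⁺ (AllPairs.map (λ x≢y {_} (z∈fx , z∈fy) → x≢y (separated z∈fx z∈fy)) xs-unique))

map-Unique : ∀ {A B : Set} (f : A → B) {xs} → (∀ {x y} → x ∈ xs → y ∈ xs → f x ≡ f y → x ≡ y) →
             Unique xs → Unique (map f xs)
map-Unique f {[]}     _         []              = []
map-Unique f {x ∷ xs} injective (x≢xs ∷ unique) =
  All.map⁺ (All.tabulate (λ y∈ fx≡fy → All.lookup x≢xs y∈ (injective (here refl) (there y∈) fx≡fy))) ∷
  map-Unique f (λ x∈ y∈ → injective (there x∈) (there y∈)) unique

<-∉ : ∀ {M} xs → All (_< M) xs → M ∉ xs
<-∉ xs <M M∈ = <-irrefl refl (All.lookup <M M∈)

≤∧∉⇒< : ∀ {M} xs → All (_≤ M) xs → M ∉ xs → All (_< M) xs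
≤∧∉⇒< xs ≤M M∉ = All.tabulate (λ {z} z∈ → ≤∧≢⇒< (All.lookup ≤M z∈) (λ z≡M → M∉ (subst (_∈ xs) z≡M z∈)))

insert₂-↭ : ∀ (x : ℕ) xs zs ws → xs ++ x ∷ zs ++ x ∷ ws ↭ x ∷ x ∷ xs ++ zs ++ ws
insert₂-↭ x xs zs ws = ↭.trans (shift x xs (zs ++ x ∷ ws)) (↭.prep x
  (subst₂ (λ l l′ → l ↭ x ∷ l′) (++-assoc xs zs (x ∷ ws)) (++-assoc xs zs ws) (shift x (xs ++ zs) ws)))

firstSplit : ∀ {M : ℕ} e → M ∈ e → Σ (List ℕ) λ xs → Σ (List ℕ) λ ys → e ≡ xs ++ M ∷ ys × M ∉ xs
firstSplit {M} (y ∷ e) M∈ with M ≟ y | M∈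
... | yes refl | _         = [] , e , refl , λ ()
... | no  M≢y  | here M≡y  = contradiction M≡y M≢y
... | no  M≢y  | there M∈e =
  let (xs , ys , e≡ , M∉xs) = firstSplit e M∈e in
  y ∷ xs , ys , cong (y ∷_) e≡ , λ { (here M≡y) → M≢y M≡y ; (there M∈xs) → M∉xs M∈xs }

firstSplit-unique : ∀ {M : ℕ} xs ys xs′ ys′ → M ∉ xs → M ∉ xs′ →
                    xs ++ M ∷ ys ≡ xs′ ++ M ∷ ys′ → xs ≡ xs′ × ys ≡ ys′
firstSplit-unique []       ys []         ys′ _    _     eq = refl , ∷-injectiveʳ eq
firstSplit-unique []       ys (x′ ∷ xs′) ys′ _    M∉xs′ eq = contradiction (here (∷-injectiveˡ eq)) M∉xs′
firstSplit-unique (x ∷ xs) ys []         ys′ M∉xs _     eq = contradiction (here (sym (∷-injectiveˡ eq))) M∉xs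
firstSplit-unique (x ∷ xs) ys (x′ ∷ xs′) ys′ M∉xs M∉xs′ eq
  with refl ← ∷-injectiveˡ eq
  with refl , refl ← firstSplit-unique xs ys xs′ ys′ (M∉xs ∘ there) (M∉xs′ ∘ there) (∷-injectiveʳ eq)
  = refl , refl

occ : ℕ → List ℕ → ℕ
occ x []       = 0
occ x (y ∷ ys) with x ≟ y
... | yes _ = suc (occ x ys)
... | no  _ = occ x ys

occ-++ : ∀ x xs ys → occ x (xs ++ ys) ≡ occ x xs + occ x ys
occ-++ x []       ys = refl
occ-++ x (y ∷ xs) ys with x ≟ y
... | yes _ = cong suc (occ-++ x xs ys)
... | no  _ = occ-++ x xs ys

occ-∷-≥ : ∀ z y ys → occ z ys ≤ occ z (y ∷ ys)
occ-∷-≥ z y ys with z ≟ y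
... | yes _ = n≤1+n _
... | no  _ = ≤-refl

occ-self : ∀ x xs → occ x (x ∷ xs) ≡ suc (occ x xs)
occ-self x xs with x ≟ x
... | yes _   = refl
... | no  x≢x = contradiction refl x≢x

occ-map-suc : ∀ x xs → occ (suc x) (map suc xs) ≡ occ x xs
occ-map-suc x []       = refl
occ-map-suc x (y ∷ xs) with x ≟ y | suc x ≟ suc y
... | yes _   | yes _   = cong suc (occ-map-suc x xs)
... | no  _   | no  _   = occ-map-suc x xs
... | yes x≡y | no  x≢y = contradiction (cong suc x≡y) x≢y
... | no  x≢y | yes x≡y = contradiction (suc-injective x≡y) x≢y

occ-∉ : ∀ {x} xs → x ∉ xs → occ x xs ≡ 0
occ-∉ {x} []       _    = refl
occ-∉ {x} (y ∷ xs) x∉ with x ≟ y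
... | yes x≡y = contradiction (here x≡y) x∉
... | no  _   = occ-∉ xs (x∉ ∘ there)

∈⇒occ≥1 : ∀ {x} xs → x ∈ xs → 1 ≤ occ x xs
∈⇒occ≥1 {x} (y ∷ xs) x∈ with x ≟ y | x∈
... | yes _   | _         = s≤s z≤n
... | no  x≢y | here x≡y  = contradiction x≡y x≢y
... | no  _   | there x∈′ = ∈⇒occ≥1 xs x∈′

occ-↭ : ∀ {z xs ys} → xs ↭ ys → occ z xs ≡ occ z ys
occ-↭     ↭.refl        = refl
occ-↭ {z} (↭.prep x p) with z ≟ x
... | yes _ = cong suc (occ-↭ p)
... | no  _ = occ-↭ p
occ-↭ {z} (↭.swap {xs} {ys} x y p) = begin
  occ z (x ∷ y ∷ xs)                          ≡⟨ occ-++ z [ x ] (y ∷ xs) ⟩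
  occ z [ x ] + occ z (y ∷ xs)                ≡⟨ cong (occ z [ x ] +_) (occ-++ z [ y ] xs) ⟩
  occ z [ x ] + (occ z [ y ] + occ z xs)      ≡⟨ x∙yz≈y∙xz (occ z [ x ]) (occ z [ y ]) (occ z xs) ⟩
  occ z [ y ] + (occ z [ x ] + occ z xs)      ≡⟨ cong (λ k → occ z [ y ] + (occ z [ x ] + k)) (occ-↭ p) ⟩
  occ z [ y ] + (occ z [ x ] + occ z ys)      ≡⟨ cong (occ z [ y ] +_) (occ-++ z [ x ] ys) ⟨
  occ z [ y ] + occ z (x ∷ ys)                ≡⟨ occ-++ z [ y ] (x ∷ ys) ⟨
  occ z (y ∷ x ∷ ys)                          ∎
  where open ≡-Reasoning
occ-↭     (↭.trans p q) = trans (occ-↭ p) (occ-↭ q)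

occ-concatMap-++ : ∀ {A : Set} x (f g : A → List ℕ) xs →
                   occ x (concatMap (λ y → f y ++ g y) xs) ≡ occ x (concatMap f xs) + occ x (concatMap g xs)
occ-concatMap-++ x f g []       = refl
occ-concatMap-++ x f g (y ∷ xs) = begin
  occ x ((f y ++ g y) ++ concatMap (λ y → f y ++ g y) xs)
    ≡⟨ occ-++ x (f y ++ g y) _ ⟩
  occ x (f y ++ g y) + occ x (concatMap (λ y → f y ++ g y) xs)
    ≡⟨ cong₂ _+_ (occ-++ x (f y) (g y)) (occ-concatMap-++ x f g xs) ⟩
  (occ x (f y) + occ x (g y)) + (occ x (concatMap f xs) + occ x (concatMap g xs))
    ≡⟨ interchange (occ x (f y)) _ _ _ ⟩
  (occ x (f y) + occ x (concatMap f xs)) + (occ x (g y) + occ x (concatMap g xs))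
    ≡⟨ cong₂ _+_ (occ-++ x (f y) _) (occ-++ x (g y) _) ⟨
  occ x (f y ++ concatMap f xs) + occ x (g y ++ concatMap g xs) ∎
  where open ≡-Reasoning

-- Labels in the generating tree

downTo1 : ℕ → List ℕ
downTo1 = applyDownFrom suc

dominated : List ℕ → List ℕ
dominated = concatMap downTo1

All-downTo1 : ∀ n → All (λ z → 1 ≤ z × z ≤ n) (downTo1 n)
All-downTo1 zero    = []
All-downTo1 (suc n) = (s≤s z≤n , ≤-refl) ∷ All.map (map₂ m≤n⇒m≤1+n) (All-downTo1 n)

All-dominated : ∀ {B} xs → All (_≤ B) xs → All (λ z → 1 ≤ z × z ≤ B) (dominated xs)
All-dominated xs ≤B =
  All.concat⁺ (All.map⁺ (All.map (λ {y} y≤B → All.map (map₂ (λ z≤y → ≤-trans z≤y y≤B)) (All-downTo1 y)) ≤B))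

occ-downTo1-step : ∀ x y → 1 ≤ x → occ x (downTo1 y) ≡ occ x [ y ] + occ (suc x) (downTo1 y)
occ-downTo1-step (suc x) zero    _ = refl
occ-downTo1-step x       (suc y) 1≤x = begin
  occ x (suc y ∷ downTo1 y)
    ≡⟨ occ-++ x [ suc y ] (downTo1 y) ⟩
  occ x [ suc y ] + occ x (downTo1 y)
    ≡⟨ cong (occ x [ suc y ] +_) (occ-downTo1-step x y 1≤x) ⟩
  occ x [ suc y ] + (occ x [ y ] + occ (suc x) (downTo1 y))
    ≡⟨ cong (λ k → occ x [ suc y ] + (k + occ (suc x) (downTo1 y))) (occ-map-suc x [ y ]) ⟨
  occ x [ suc y ] + (occ (suc x) [ suc y ] + occ (suc x) (downTo1 y))
    ≡⟨ cong (occ x [ suc y ] +_) (occ-++ (suc x) [ suc y ] (downTo1 y)) ⟨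
  occ x [ suc y ] + occ (suc x) (suc y ∷ downTo1 y) ∎
  where open ≡-Reasoning

occ-dominated-step : ∀ x xs → 1 ≤ x → occ x (dominated xs) ≡ occ x xs + occ (suc x) (dominated xs)
occ-dominated-step x []       _   = refl
occ-dominated-step x (y ∷ xs) 1≤x = begin
  occ x (downTo1 y ++ dominated xs)
    ≡⟨ occ-++ x (downTo1 y) _ ⟩
  occ x (downTo1 y) + occ x (dominated xs)
    ≡⟨ cong₂ _+_ (occ-downTo1-step x y 1≤x) (occ-dominated-step x xs 1≤x) ⟩
  (occ x [ y ] + occ (suc x) (downTo1 y)) + (occ x xs + occ (suc x) (dominated xs))
    ≡⟨ interchange (occ x [ y ]) _ _ _ ⟩
  (occ x [ y ] + occ x xs) + (occ (suc x) (downTo1 y) + occ (suc x) (dominated xs))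
    ≡⟨ cong₂ _+_ (occ-++ x [ y ] xs) (occ-++ (suc x) (downTo1 y) _) ⟨
  occ x (y ∷ xs) + occ (suc x) (downTo1 y ++ dominated xs) ∎
  where open ≡-Reasoning

occ-1-downTo1 : ∀ n → occ 1 (downTo1 (suc n)) ≡ 1
occ-1-downTo1 zero    = refl
occ-1-downTo1 (suc n) = occ-1-downTo1 n

length≡occ-1-dominated : ∀ xs → All (1 ≤_) xs → length xs ≡ occ 1 (dominated xs)
length≡occ-1-dominated []           []         = refl
length≡occ-1-dominated (suc y ∷ xs) (_ ∷ 1≤xs) = begin
  suc (length xs)
    ≡⟨ cong₂ _+_ (occ-1-downTo1 y) (sym (length≡occ-1-dominated xs 1≤xs)) ⟨
  occ 1 (downTo1 (suc y)) + occ 1 (dominated xs)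
    ≡⟨ occ-++ 1 (downTo1 (suc y)) _ ⟨
  occ 1 (dominated (suc y ∷ xs)) ∎
  where open ≡-Reasoning

data Code : Set where
  apart    : (s u a : ℕ) → Code
  adjacent : (u a : ℕ) → Code

apartCodes adjacentCodes codes : ℕ → List Code
apartCodes    ℓ = concatMap (λ s → concatMap (λ u → map (apart s u) (downTo1 u)) (downTo1 s)) (downTo1 ℓ)
adjacentCodes ℓ = concatMap (λ u → map (adjacent u) (downTo1 u)) (downTo1 ℓ)
codes         ℓ = apartCodes ℓ ++ adjacentCodes ℓ

codeLabel : Code → ℕ
codeLabel (apart s u a)  = a
codeLabel (adjacent u a) = suc a

childLabels : ℕ → List ℕ
childLabels ℓ = map codeLabel (codes ℓ)

childLabels≡dominated : ∀ ℓ → childLabels ℓ ≡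
                        dominated (dominated (downTo1 ℓ)) ++ map suc (dominated (downTo1 ℓ))
childLabels≡dominated ℓ = trans (map-++ codeLabel (apartCodes ℓ) _) (cong₂ _++_ apartLabels adjacentLabels)
  where
  open ≡-Reasoning
  apartLabels : map codeLabel (apartCodes ℓ) ≡ dominated (dominated (downTo1 ℓ))
  apartLabels = begin
    map codeLabel (apartCodes ℓ)
      ≡⟨ map-concatMap codeLabel _ (downTo1 ℓ) ⟩
    concatMap (λ s → map codeLabel (concatMap (λ u → map (apart s u) (downTo1 u)) (downTo1 s))) (downTo1 ℓ)
      ≡⟨ concatMap-cong (λ s → map-concatMap codeLabel _ (downTo1 s)) (downTo1 ℓ) ⟩
    concatMap (λ s → concatMap (λ u → map codeLabel (map (apart s u) (downTo1 u))) (downTo1 s)) (downTo1 ℓ)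
      ≡⟨ concatMap-cong (λ s → concatMap-cong (λ u → trans (sym (map-∘ (downTo1 u))) (map-id (downTo1 u)))
                                              (downTo1 s))
                        (downTo1 ℓ) ⟩
    concatMap (dominated ∘′ downTo1) (downTo1 ℓ)
      ≡⟨ concatMap-concatMap downTo1 downTo1 (downTo1 ℓ) ⟨
    dominated (dominated (downTo1 ℓ))
      ∎
  adjacentLabels : map codeLabel (adjacentCodes ℓ) ≡ map suc (dominated (downTo1 ℓ))
  adjacentLabels = begin
    map codeLabel (adjacentCodes ℓ)
      ≡⟨ map-concatMap codeLabel _ (downTo1 ℓ) ⟩
    concatMap (λ u → map codeLabel (map (adjacent u) (downTo1 u))) (downTo1 ℓ)
      ≡⟨ concatMap-cong (λ u → sym (map-∘ (downTo1 u))) (downTo1 ℓ) ⟩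
    concatMap (map suc ∘′ downTo1) (downTo1 ℓ)
      ≡⟨ map-concatMap suc downTo1 (downTo1 ℓ) ⟨
    map suc (dominated (downTo1 ℓ))
      ∎

labelsAt : ℕ → List ℕ
labelsAt zero    = [ 1 ]
labelsAt (suc m) = concatMap childLabels (labelsAt m)

childLabels-bounded : ∀ {B} ℓ → ℓ ≤ B → All (λ y → 1 ≤ y × y ≤ suc B) (childLabels ℓ)
childLabels-bounded ℓ ℓ≤B = subst (All _) (sym (childLabels≡dominated ℓ))
  (All.++⁺ (All.map (map₂ m≤n⇒m≤1+n) dominated²)
           (All.map⁺ (All.map (λ (_ , z≤B) → s≤s z≤n , s≤s z≤B) dominated¹)))
  where
  dominated¹ = All-dominated (downTo1 ℓ) (All.map (λ (_ , z≤ℓ) → ≤-trans z≤ℓ ℓ≤B) (All-downTo1 ℓ))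
  dominated² = All-dominated (dominated (downTo1 ℓ)) (All.map proj₂ dominated¹)

labelsAt-bounded : ∀ m → All (λ y → 1 ≤ y × y ≤ suc m) (labelsAt m)
labelsAt-bounded zero    = (s≤s z≤n , s≤s z≤n) ∷ []
labelsAt-bounded (suc m) =
  All.concat⁺ (All.map⁺ (All.map (λ (_ , ℓ≤m+1) → childLabels-bounded _ ℓ≤m+1) (labelsAt-bounded m)))

-- multiplicity m i k is the number of occurrences of the label i + 1 in the
-- k-fold iterate of dominated on labelsAt m.
multiplicity : ℕ → ℕ → ℕ → ℕ
multiplicity m       zero    k = raney m (suc k)
multiplicity zero    (suc i) k = 0
multiplicity (suc m) (suc i) k = multiplicity m i (k + 3)

multiplicity-step : ∀ m i k →
                    multiplicity m i (suc k) ≡ multiplicity m i k + multiplicity m (suc i) (suc k)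
multiplicity-step zero    zero    k = refl
multiplicity-step (suc m) zero    k = cong (λ j → raney (suc m) (suc k) + raney m j) (+-suc (suc k) 3)
multiplicity-step zero    (suc i) k = refl
multiplicity-step (suc m) (suc i) k = multiplicity-step m i (k + 3)

m<i⇒multiplicity≡0 : ∀ m i k → m < i → multiplicity m i k ≡ 0
m<i⇒multiplicity≡0 zero    (suc i) k _         = refl
m<i⇒multiplicity≡0 (suc m) (suc i) k (s≤s m<i) = m<i⇒multiplicity≡0 m i (k + 3) m<i

occ-dominated-multiplicity : ∀ m k xs → All (_≤ suc m) xs → (∀ i → occ (suc i) xs ≡ multiplicity m i k) →
                             ∀ i → occ (suc i) (dominated xs) ≡ multiplicity m i (suc k)
occ-dominated-multiplicity m k xs ≤m+1 occ≡ i = downward (suc m) i (m≤m+n (suc m) i)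
  where
  downward : ∀ d i → suc m ≤ d + i → occ (suc i) (dominated xs) ≡ multiplicity m i (suc k)
  downward zero    i m<i = trans
    (occ-∉ (dominated xs) (λ i+1∈ → <⇒≱ (s≤s m<i) (proj₂ (All.lookup (All-dominated xs ≤m+1) i+1∈))))
    (sym (m<i⇒multiplicity≡0 m i (suc k) m<i))
  downward (suc d) i m<d+i = begin
    occ (suc i) (dominated xs)
      ≡⟨ occ-dominated-step (suc i) xs (s≤s z≤n) ⟩
    occ (suc i) xs + occ (suc (suc i)) (dominated xs)
      ≡⟨ cong₂ _+_ (occ≡ i) (downward d (suc i) (subst (suc m ≤_) (sym (+-suc d i)) m<d+i)) ⟩
    multiplicity m i k + multiplicity m (suc i) (suc k)
      ≡⟨ multiplicity-step m i k ⟨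
    multiplicity m i (suc k) ∎
    where open ≡-Reasoning

occ-concatMap-childLabels : ∀ x xs → occ x (concatMap childLabels xs) ≡
                            occ x (dominated (dominated (dominated xs))) + occ x (map suc (dominated (dominated xs)))
occ-concatMap-childLabels x xs = begin
  occ x (concatMap childLabels xs)
    ≡⟨ cong (occ x) (concatMap-cong childLabels≡dominated xs) ⟩
  occ x (concatMap (λ ℓ → dominated (dominated (downTo1 ℓ)) ++ map suc (dominated (downTo1 ℓ))) xs)
    ≡⟨ occ-concatMap-++ x _ _ xs ⟩
  occ x (concatMap (dominated ∘′ dominated ∘′ downTo1) xs) + occ x (concatMap (map suc ∘′ dominated ∘′ downTo1) xs)
    ≡⟨ cong₂ (λ ys zs → occ x ys + occ x zs) dominated³ (sym (map-concatMap suc _ xs)) ⟩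
  occ x (dominated (dominated (dominated xs))) + occ x (map suc (concatMap (dominated ∘′ downTo1) xs))
    ≡⟨ cong (λ ys → occ x (dominated (dominated (dominated xs))) + occ x (map suc ys))
            (concatMap-concatMap downTo1 downTo1 xs) ⟨
  occ x (dominated (dominated (dominated xs))) + occ x (map suc (dominated (dominated xs))) ∎
  where
  open ≡-Reasoning
  dominated³ : concatMap (dominated ∘′ dominated ∘′ downTo1) xs ≡ dominated (dominated (dominated xs))
  dominated³ = begin
    concatMap (dominated ∘′ dominated ∘′ downTo1) xs
      ≡⟨ concatMap-cong (λ y → concatMap-concatMap downTo1 downTo1 (downTo1 y)) xs ⟩
    concatMap (concatMap (dominated ∘′ downTo1) ∘′ downTo1) xs
      ≡⟨ concatMap-concatMap (dominated ∘′ downTo1) downTo1 xs ⟨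
    concatMap (dominated ∘′ downTo1) (dominated xs)
      ≡⟨ concatMap-concatMap downTo1 downTo1 (dominated xs) ⟨
    dominated (dominated (dominated xs)) ∎

occ-labelsAt : ∀ m i → occ (suc i) (labelsAt m) ≡ multiplicity m i 0
occ-labelsAt zero    zero    = refl
occ-labelsAt zero    (suc i) = refl
occ-labelsAt (suc m) i       = trans (occ-concatMap-childLabels (suc i) L) (last i)
  where
  L  = labelsAt m
  L¹ = dominated L
  L² = dominated L¹
  ≤m+1  = All.map proj₂ (labelsAt-bounded m)
  ≤m+1¹ = All.map proj₂ (All-dominated L ≤m+1)
  occ¹ = occ-dominated-multiplicity m 0 L ≤m+1 (occ-labelsAt m)
  occ² = occ-dominated-multiplicity m 1 L¹ ≤m+1¹ occ¹
  occ³ = occ-dominated-multiplicity m 2 L² (All.map proj₂ (All-dominated L¹ ≤m+1¹)) occ²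
  last : ∀ i → occ (suc i) (dominated L²) + occ (suc i) (map suc L²) ≡ multiplicity (suc m) i 0
  last zero = begin
    occ 1 (dominated L²) + occ 1 (map suc L²)   ≡⟨ cong₂ _+_ (occ³ 0) (occ-map-suc 0 L²) ⟩
    raney m 4 + occ 0 L²                        ≡⟨ cong (raney m 4 +_) (occ-∉ L² 0∉L²) ⟩
    raney m 4 + 0                               ≡⟨ +-identityʳ _ ⟩
    raney m 4                                   ∎
    where
    open ≡-Reasoning
    0∉L² : 0 ∉ L²
    0∉L² 0∈ = <⇒≱ z<s (proj₁ (All.lookup (All-dominated L¹ ≤m+1¹) 0∈))
  last (suc i) = begin
    occ (2 + i) (dominated L²) + occ (2 + i) (map suc L²)
      ≡⟨ cong₂ _+_ (occ³ (suc i)) (trans (occ-map-suc (suc i) L²) (occ² i)) ⟩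
    multiplicity m (suc i) 3 + multiplicity m i 2
      ≡⟨ +-comm _ (multiplicity m i 2) ⟩
    multiplicity m i 2 + multiplicity m (suc i) 3
      ≡⟨ multiplicity-step m i 2 ⟨
    multiplicity m i 3 ∎
    where open ≡-Reasoning

length-labelsAt : ∀ m → length (labelsAt m) ≡ raney m 2
length-labelsAt m = trans (length≡occ-1-dominated (labelsAt m) (All.map proj₁ (labelsAt-bounded m)))
  (occ-dominated-multiplicity m 0 (labelsAt m) (All.map proj₂ (labelsAt-bounded m)) (occ-labelsAt m) 0)

-- The defining conditions, recursively

IsInversionFrom : ℕ → List ℕ → Set
IsInversionFrom s []       = ⊤
IsInversionFrom s (x ∷ xs) = x ≤ s × IsInversionFrom (suc s) xs

isInversionFrom⇔ : ∀ s e → IsInversionFrom s e ⇔ ((j : Fin (length e)) → lookup e j ≤ s + toℕ j)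
isInversionFrom⇔ s e = mk⇔ (to s e) (from s e)
  where
  to : ∀ s e → IsInversionFrom s e → (j : Fin (length e)) → lookup e j ≤ s + toℕ j
  to s (x ∷ xs) (x≤s , _)   zero    = ≤-trans x≤s (m≤m+n s 0)
  to s (x ∷ xs) (_ , inv) (suc j) = subst (lookup xs j ≤_) (sym (+-suc s (toℕ j))) (to (suc s) xs inv j)
  from : ∀ s e → ((j : Fin (length e)) → lookup e j ≤ s + toℕ j) → IsInversionFrom s e
  from s []       _     = tt
  from s (x ∷ xs) bound = subst (x ≤_) (+-identityʳ s) (bound zero) ,
                          from (suc s) xs (λ j → subst (lookup xs j ≤_) (+-suc s (toℕ j)) (bound (suc j)))

All-tabulate-lookup : ∀ {P : ℕ → Set} xs → ((k : Fin (length xs)) → P (lookup xs k)) → All P xs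
All-tabulate-lookup []       _ = []
All-tabulate-lookup (x ∷ xs) p = p zero ∷ All-tabulate-lookup xs (λ k → p (suc k))

Straddled : ℕ → List ℕ → Set
Straddled x ys = Σ (Fin (length ys)) λ j → Σ (Fin (length ys)) λ k →
  (toℕ j < toℕ k) × (lookup ys j < x) × (x < lookup ys k)

No102Starting : ℕ → List ℕ → Set
No102Starting x []       = ⊤
No102Starting x (y ∷ ys) = (y < x → All (_≤ x) ys) × No102Starting x ys

Avoids102 : List ℕ → Set
Avoids102 []       = ⊤
Avoids102 (x ∷ xs) = No102Starting x xs × Avoids102 xs

no102Starting⇔ : ∀ x ys → No102Starting x ys ⇔ (¬ Straddled x ys)
no102Starting⇔ x ys = mk⇔ (to ys) (from ys)
  where
  to : ∀ ys → No102Starting x ys → ¬ Straddled x ys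
  to (y ∷ ys) (y<x⇒≤x , _) (zero  , suc k , _       , y<x  , x<z) = <⇒≱ x<z (All.lookup (y<x⇒≤x y<x) (∈-lookup k))
  to (y ∷ ys) (_ , no102)  (suc j , suc k , s≤s j<k , yⱼ<x , x<z) = to ys no102 (j , k , j<k , yⱼ<x , x<z)
  from : ∀ ys → ¬ Straddled x ys → No102Starting x ys
  from []       _  = tt
  from (y ∷ ys) ¬s =
    (λ y<x → All-tabulate-lookup ys (λ k → ≮⇒≥ (λ x<z → ¬s (zero , suc k , s≤s z≤n , y<x , x<z)))) ,
    from ys (λ (j , k , j<k , yⱼ<x , x<z) → ¬s (suc j , suc k , s≤s j<k , yⱼ<x , x<z))

avoids102⇔ : ∀ e → Avoids102 e ⇔ (¬ Contains102 e)
avoids102⇔ e = mk⇔ (to e) (from e)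
  where
  to : ∀ e → Avoids102 e → ¬ Contains102 e
  to (x ∷ xs) (no102 , _) (zero  , suc j , suc k , _       , s≤s j<k , yⱼ<x , x<z) =
    Equivalence.to (no102Starting⇔ x xs) no102 (j , k , j<k , yⱼ<x , x<z)
  to (x ∷ xs) (_ , avoids) (suc i , suc j , suc k , s≤s i<j , s≤s j<k , p) = to xs avoids (i , j , k , i<j , j<k , p)
  from : ∀ e → ¬ Contains102 e → Avoids102 e
  from []       _  = tt
  from (x ∷ xs) ¬c =
    Equivalence.from (no102Starting⇔ x xs) (λ (j , k , j<k , p) → ¬c (zero , suc j , suc k , s≤s z≤n , s≤s j<k , p)) ,
    from xs (λ (i , j , k , i<j , j<k , p) → ¬c (suc i , suc j , suc k , s≤s i<j , s≤s j<k , p))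

AtMostTwice : List ℕ → Set
AtMostTwice e = ∀ z → occ z e ≤ 2

Once Twice : ℕ → List ℕ → Set
Once  x ys = Σ (Fin (length ys)) λ k → lookup ys k ≡ x
Twice x ys = Σ (Fin (length ys)) λ j → Σ (Fin (length ys)) λ k →
  (toℕ j < toℕ k) × (lookup ys j ≡ x) × (lookup ys k ≡ x)

once⇔ : ∀ x ys → Once x ys ⇔ (1 ≤ occ x ys)
once⇔ x ys = mk⇔ (to ys) (from ys)
  where
  to : ∀ ys → Once x ys → 1 ≤ occ x ys
  to (y ∷ ys) (zero , y≡x) with x ≟ y
  ... | yes _   = s≤s z≤n
  ... | no  x≢y = contradiction (sym y≡x) x≢y
  to (y ∷ ys) (suc k , p) = ≤-trans (to ys (k , p)) (occ-∷-≥ x y ys)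
  from : ∀ ys → 1 ≤ occ x ys → Once x ys
  from (y ∷ ys) 1≤occ with x ≟ y
  ... | yes x≡y = zero , sym x≡y
  ... | no  _   = let (k , p) = from ys 1≤occ in suc k , p

twice⇔ : ∀ x ys → Twice x ys ⇔ (2 ≤ occ x ys)
twice⇔ x ys = mk⇔ (to ys) (from ys)
  where
  to : ∀ ys → Twice x ys → 2 ≤ occ x ys
  to (y ∷ ys) (zero , suc k , _ , y≡x , p) with x ≟ y
  ... | yes _   = s≤s (Equivalence.to (once⇔ x ys) (k , p))
  ... | no  x≢y = contradiction (sym y≡x) x≢y
  to (y ∷ ys) (suc j , suc k , s≤s j<k , p) = ≤-trans (to ys (j , k , j<k , p)) (occ-∷-≥ x y ys)
  from : ∀ ys → 2 ≤ occ x ys → Twice x ys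
  from (y ∷ ys) 2≤occ with x ≟ y
  ... | yes x≡y = let (k , p) = Equivalence.from (once⇔ x ys) (≤-pred 2≤occ) in
                  zero , suc k , s≤s z≤n , sym x≡y , p
  ... | no  _   = let (j , k , j<k , p) = from ys 2≤occ in suc j , suc k , s≤s j<k , p

atMostTwice⇔ : ∀ e → AtMostTwice e ⇔ (¬ Contains000 e)
atMostTwice⇔ e = mk⇔ (to e) (from e)
  where
  to : ∀ e → AtMostTwice e → ¬ Contains000 e
  to (x ∷ xs) ≤2 (zero , suc j , suc k , _ , s≤s j<k , x≡yⱼ , yⱼ≡yₖ) =
    <⇒≱ (s≤s (Equivalence.to (twice⇔ x xs) (j , k , j<k , sym x≡yⱼ , trans (sym yⱼ≡yₖ) (sym x≡yⱼ))))
        (subst (_≤ 2) (occ-self x xs) (≤2 x))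
  to (x ∷ xs) ≤2 (suc i , suc j , suc k , s≤s i<j , s≤s j<k , p) =
    to xs (λ z → ≤-trans (occ-∷-≥ z x xs) (≤2 z)) (i , j , k , i<j , j<k , p)
  from : ∀ e → ¬ Contains000 e → AtMostTwice e
  from []       _  z = z≤n
  from (x ∷ xs) ¬c z with z ≟ x
  ... | yes refl = s≤s (≮⇒≥ λ 2≤occ →
    let (j , k , j<k , yⱼ≡z , yₖ≡z) = Equivalence.from (twice⇔ z xs) 2≤occ in
    ¬c (zero , suc j , suc k , s≤s z≤n , s≤s j<k , sym yⱼ≡z , trans yⱼ≡z (sym yₖ≡z)))
  ... | no  _    = from xs (λ (i , j , k , i<j , j<k , p) → ¬c (suc i , suc j , suc k , s≤s i<j , s≤s j<k , p)) z

Admissible : ℕ → List ℕ → Set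
Admissible m e = IsInversionFrom 0 e × Avoids102 e × AtMostTwice e × dist e ≡ m

admissible⇔counted : ∀ m e → Admissible m e ⇔ Counted m e
admissible⇔counted m e = mk⇔
  (λ (inv , a102 , a000 , d) →
     to (isInversionFrom⇔ 0 e) inv , (to (avoids102⇔ e) a102 , to (atMostTwice⇔ e) a000) , d)
  (λ (inv , (a102 , a000) , d) →
     from (isInversionFrom⇔ 0 e) inv , from (avoids102⇔ e) a102 , from (atMostTwice⇔ e) a000 , d)
  where open Equivalence

dist-cong : ∀ {xs ys} → (∀ {z} → z ∈ xs → z ∈ ys) → (∀ {z} → z ∈ ys → z ∈ xs) → dist xs ≡ dist ys
dist-cong {xs} {ys} xs⊆ys ys⊆xs = ↭-length (∼bag⇒↭ (unique∧set⇒bag (deduplicate-! xs) (deduplicate-! ys)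
  (mk⇔ (∈-deduplicate⁺ _≟_ ∘ xs⊆ys ∘ ∈-deduplicate⁻ _≟_ xs)
       (∈-deduplicate⁺ _≟_ ∘ ys⊆xs ∘ ∈-deduplicate⁻ _≟_ ys))))

dist-↭ : ∀ {xs ys} → xs ↭ ys → dist xs ≡ dist ys
dist-↭ p = dist-cong (∈-resp-↭ p) (∈-resp-↭ (↭-sym p))

dist-∷-∉ : ∀ {x} xs → x ∉ xs → dist (x ∷ xs) ≡ suc (dist xs)
dist-∷-∉ {x} xs x∉ = cong (suc ∘ length) (filter-all (¬? ∘ (x ≟_))
  (All.tabulate (λ z∈ x≡z → x∉ (subst (_∈ xs) (sym x≡z) (∈-deduplicate⁻ _≟_ xs z∈)))))

dist-∷-∈ : ∀ {x} xs → x ∈ xs → dist (x ∷ xs) ≡ dist xs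
dist-∷-∈ xs x∈ = dist-cong (λ { (here refl) → x∈ ; (there z∈) → z∈ }) there

dist≡0⇒[] : ∀ (xs : List ℕ) → dist xs ≡ 0 → xs ≡ []
dist≡0⇒[] []      _  = refl
dist≡0⇒[] (x ∷ xs) ()

top : List ℕ → ℕ
top e = max 0 (map suc e)

All-<-top : ∀ e → All (_< top e) e
All-<-top e = All.map⁻ (xs≤max 0 (map suc e))

top-≤ : ∀ {B} e → All (_< B) e → top e ≤ B
top-≤ e <B = max≤v⁺ z≤n (All.map⁺ <B)

top≤⇒All< : ∀ {M} e → top e ≤ M → All (_< M) e
top≤⇒All< e t≤M = All.map (λ x<t → ≤-trans x<t t≤M) (All-<-top e)

top-≡ : ∀ {M} e → M ∈ e → All (_≤ M) e → top e ≡ suc M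
top-≡ e M∈ ≤M = ≤-antisym (top-≤ e (All.map s≤s ≤M)) (All.lookup (All-<-top e) M∈)

maximum : ∀ x xs → Σ ℕ λ M → M ∈ x ∷ xs × All (_≤ M) (x ∷ xs)
maximum x xs = max x xs , max∈ , ⊥≤max x xs ∷ xs≤max x xs
  where
  max∈ : max x xs ∈ x ∷ xs
  max∈ with argmax-sel (λ y → y) x xs
  ... | inj₁ max≡x = here max≡x
  ... | inj₂ max∈xs = there max∈xs

Sorted : List ℕ → Set
Sorted = AllPairs _≤_

Sorted-++⁻ˡ : ∀ xs {ys} → Sorted (xs ++ ys) → Sorted xs
Sorted-++⁻ˡ []       _                 = []
Sorted-++⁻ˡ (x ∷ xs) (x≤xsys ∷ sorted) = All.++⁻ˡ xs x≤xsys ∷ Sorted-++⁻ˡ xs sorted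

wipFrom : ℕ → List ℕ → ℕ
wipFrom p []       = 0
wipFrom p (y ∷ ys) with p ≤? y
... | yes _ = suc (wipFrom y ys)
... | no  _ = 0

-- The length of the longest weakly increasing prefix.
wip : List ℕ → ℕ
wip = wipFrom 0

wipFrom≤length : ∀ p ys → wipFrom p ys ≤ length ys
wipFrom≤length p []       = z≤n
wipFrom≤length p (y ∷ ys) with p ≤? y
... | yes _ = s≤s (wipFrom≤length y ys)
... | no  _ = z≤n

sorted⇒≤wipFrom : ∀ {p} xs ys → All (p ≤_) xs → Sorted xs → length xs ≤ wipFrom p (xs ++ ys)
sorted⇒≤wipFrom {p} []       ys _         _               = z≤n
sorted⇒≤wipFrom {p} (x ∷ xs) ys (p≤x ∷ _) (x≤xs ∷ sorted) with p ≤? x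
... | yes _   = s≤s (sorted⇒≤wipFrom xs ys x≤xs sorted)
... | no  p≰x = contradiction p≤x p≰x

≤wipFrom⇒sorted : ∀ {p} xs ys → length xs ≤ wipFrom p (xs ++ ys) → All (p ≤_) xs × Sorted xs
≤wipFrom⇒sorted {p} []       ys _ = [] , []
≤wipFrom⇒sorted {p} (x ∷ xs) ys ≤wip with p ≤? x | ≤wip
... | yes p≤x | s≤s ≤wip′ = let (x≤xs , sorted) = ≤wipFrom⇒sorted xs ys ≤wip′ in
                            p≤x ∷ All.map (≤-trans p≤x) x≤xs , x≤xs ∷ sorted
... | no  _   | ()

wipFrom-insert : ∀ {p M} xs ys → All (p ≤_) xs → Sorted xs → All (_≤ M) xs → p ≤ M →
                 wipFrom p (xs ++ M ∷ ys) ≡ length xs + suc (wipFrom M ys)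
wipFrom-insert {p} {M} []       ys _ _ _ p≤M with p ≤? M
... | yes _   = refl
... | no  p≰M = contradiction p≤M p≰M
wipFrom-insert {p} {M} (x ∷ xs) ys (p≤x ∷ _) (x≤xs ∷ sorted) (x≤M ∷ ≤M) _ with p ≤? x
... | yes _   = cong suc (wipFrom-insert xs ys x≤xs sorted ≤M x≤M)
... | no  p≰x = contradiction p≤x p≰x

wip-insert : ∀ {M} xs ys → Sorted xs → All (_≤ M) xs →
             wip (xs ++ M ∷ ys) ≡ length xs + suc (wipFrom M ys)
wip-insert xs ys sorted ≤M = wipFrom-insert xs ys (All.tabulate (λ _ → z≤n)) sorted ≤M z≤n

wipFrom-< : ∀ {M y} ys → y < M → wipFrom M (y ∷ ys) ≡ 0
wipFrom-< {M} {y} ys y<M with M ≤? y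
... | yes M≤y = contradiction M≤y (<⇒≱ y<M)
... | no  _   = refl

wipFrom-self : ∀ M ys → wipFrom M (M ∷ ys) ≡ suc (wipFrom M ys)
wipFrom-self M ys with M ≤? M
... | yes _   = refl
... | no  M≰M = contradiction ≤-refl M≰M

wipFrom-All< : ∀ {M} ys → All (_< M) ys → wipFrom M ys ≡ 0
wipFrom-All< []       _         = refl
wipFrom-All< (y ∷ ys) (y<M ∷ _) = wipFrom-< ys y<M

IsInversionFrom-suc : ∀ s e → IsInversionFrom s e → IsInversionFrom (suc s) e
IsInversionFrom-suc s []      _           = tt
IsInversionFrom-suc s (x ∷ e) (x≤s , inv) = m≤n⇒m≤1+n x≤s , IsInversionFrom-suc (suc s) e inv

All≤⇒IsInversionFrom : ∀ s e → All (_≤ s) e → IsInversionFrom s e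
All≤⇒IsInversionFrom s []      []         = tt
All≤⇒IsInversionFrom s (x ∷ e) (x≤s ∷ ≤s) = x≤s , All≤⇒IsInversionFrom (suc s) e (All.map m≤n⇒m≤1+n ≤s)

IsInversionFrom-insert : ∀ s M xs ys → IsInversionFrom s (xs ++ ys) → M ≤ s + length xs →
                         IsInversionFrom s (xs ++ M ∷ ys)
IsInversionFrom-insert s M []       ys inv         M≤ = subst (M ≤_) (+-identityʳ s) M≤ , IsInversionFrom-suc s ys inv
IsInversionFrom-insert s M (x ∷ xs) ys (x≤s , inv) M≤ =
  x≤s , IsInversionFrom-insert (suc s) M xs ys inv (subst (M ≤_) (+-suc s (length xs)) M≤)

IsInversionFrom-delete : ∀ s M xs ys → IsInversionFrom s (xs ++ M ∷ ys) → All (_< M) ys →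
                         IsInversionFrom s (xs ++ ys)
IsInversionFrom-delete s M []       ys (M≤s , _)   <M =
  All≤⇒IsInversionFrom s ys (All.map (λ y<M → ≤-trans (<⇒≤ y<M) M≤s) <M)
IsInversionFrom-delete s M (x ∷ xs) ys (x≤s , inv) <M = x≤s , IsInversionFrom-delete (suc s) M xs ys inv <M

IsInversionFrom-position : ∀ s M xs ys → IsInversionFrom s (xs ++ M ∷ ys) → M ≤ s + length xs
IsInversionFrom-position s M []       ys (M≤s , _) = subst (M ≤_) (sym (+-identityʳ s)) M≤s
IsInversionFrom-position s M (x ∷ xs) ys (_ , inv) =
  subst (M ≤_) (sym (+-suc s (length xs))) (IsInversionFrom-position (suc s) M xs ys inv)

All≤⇒No102Starting : ∀ {x} ys → All (_≤ x) ys → No102Starting x ys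
All≤⇒No102Starting []       _        = tt
All≤⇒No102Starting (y ∷ ys) (_ ∷ ≤x) = (λ _ → ≤x) , All≤⇒No102Starting ys ≤x

No102Starting-delete : ∀ {x} ws y ys → No102Starting x (ws ++ y ∷ ys) → No102Starting x (ws ++ ys)
No102Starting-delete []       y ys (_ , no102)     = no102
No102Starting-delete (w ∷ ws) y ys (w<x⇒ , no102) =
  (λ w<x → All.tail (All-resp-↭ (shift y ws ys) (w<x⇒ w<x))) , No102Starting-delete ws y ys no102

Avoids102-delete : ∀ xs y ys → Avoids102 (xs ++ y ∷ ys) → Avoids102 (xs ++ ys)
Avoids102-delete []       y ys (_ , avoids)     = avoids
Avoids102-delete (x ∷ xs) y ys (no102 , avoids) = No102Starting-delete xs y ys no102 , Avoids102-delete xs y ys avoids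

No102Starting-insert : ∀ {x} M ws ys → No102Starting x (ws ++ ys) → All (x ≤_) ws → x ≤ M →
                       No102Starting x (ws ++ M ∷ ys)
No102Starting-insert M []       ys no102       _            x≤M = (λ M<x → contradiction x≤M (<⇒≱ M<x)) , no102
No102Starting-insert M (w ∷ ws) ys (_ , no102) (x≤w ∷ x≤ws) x≤M =
  (λ w<x → contradiction x≤w (<⇒≱ w<x)) , No102Starting-insert M ws ys no102 x≤ws x≤M

Avoids102-insert : ∀ M xs ys → Avoids102 (xs ++ ys) → Sorted xs → All (_≤ M) (xs ++ ys) →
                   Avoids102 (xs ++ M ∷ ys)
Avoids102-insert M []       ys avoids           _               ≤M         = All≤⇒No102Starting ys ≤M , avoids
Avoids102-insert M (x ∷ xs) ys (no102 , avoids) (x≤xs ∷ sorted) (x≤M ∷ ≤M) =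
  No102Starting-insert M xs ys no102 x≤xs x≤M , Avoids102-insert M xs ys avoids sorted ≤M

No102Starting⇒≤ : ∀ {x} M ws ys → No102Starting x (ws ++ M ∷ ys) → x < M → All (x ≤_) ws
No102Starting⇒≤     M []       ys _              _   = []
No102Starting⇒≤ {x} M (w ∷ ws) ys (w<x⇒ , no102) x<M with w <? x
... | yes w<x = contradiction (All.lookup (w<x⇒ w<x) (∈-++⁺ʳ ws (here refl))) (<⇒≱ x<M)
... | no  w≮x = ≮⇒≥ w≮x ∷ No102Starting⇒≤ M ws ys no102 x<M

Avoids102⇒Sorted : ∀ M xs ys → Avoids102 (xs ++ M ∷ ys) → All (_< M) xs → Sorted xs
Avoids102⇒Sorted M []       ys _                _           = []
Avoids102⇒Sorted M (x ∷ xs) ys (no102 , avoids) (x<M ∷ <M) =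
  No102Starting⇒≤ M xs ys no102 x<M ∷ Avoids102⇒Sorted M xs ys avoids <M

AtMostTwice-∷ : ∀ {x} e → AtMostTwice e → occ x e ≤ 1 → AtMostTwice (x ∷ e)
AtMostTwice-∷ {x} e ≤2 ≤1 z with z ≟ x
... | yes refl = s≤s ≤1
... | no  _    = ≤2 z

AtMostTwice-tail : ∀ {x} e → AtMostTwice (x ∷ e) → AtMostTwice e
AtMostTwice-tail {x} e ≤2 z = ≤-trans (occ-∷-≥ z x e) (≤2 z)

AtMostTwice-resp-↭ : ∀ {xs ys} → xs ↭ ys → AtMostTwice xs → AtMostTwice ys
AtMostTwice-resp-↭ p ≤2 z = subst (_≤ 2) (occ-↭ p) (≤2 z)

All≤-insert : ∀ {M} xs ys → All (_< M) (xs ++ ys) → All (_≤ M) (xs ++ M ∷ ys)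
All≤-insert xs ys <M = All-resp-↭ (↭-sym (shift _ xs ys)) (≤-refl ∷ All.map <⇒≤ <M)

All≤-insert₂ : ∀ {M} xs zs ws → All (_< M) (xs ++ zs ++ ws) → All (_≤ M) (xs ++ M ∷ zs ++ M ∷ ws)
All≤-insert₂ xs zs ws <M = All-resp-↭ (↭-sym (insert₂-↭ _ xs zs ws)) (≤-refl ∷ ≤-refl ∷ All.map <⇒≤ <M)

-- Inserting a new maximum

lab : List ℕ → ℕ
lab e = suc (wip e) ∸ top e

gap : Maybe ℕ → ℕ
gap nothing  = 0
gap (just v) = v

adjacencyBonus : Maybe ℕ → ℕ
adjacencyBonus (just zero) = 1
adjacencyBonus _           = 0

-- E arises from e by inserting M once at position q (nothing), or twice
-- (just v): at position q and after v further entries of e.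
data Insertion (e : List ℕ) (M q : ℕ) : Maybe ℕ → List ℕ → Set where
  once  : ∀ {E} xs ys → e ≡ xs ++ ys → E ≡ xs ++ M ∷ ys → length xs ≡ q → Insertion e M q nothing E
  twice : ∀ {E} xs zs ws → e ≡ xs ++ zs ++ ws → E ≡ xs ++ M ∷ zs ++ M ∷ ws → length xs ≡ q →
          Insertion e M q (just (length zs)) E

lab-insert : ∀ {M} xs ys → Sorted xs → All (_≤ M) (xs ++ M ∷ ys) →
             lab (xs ++ M ∷ ys) ≡ suc (length xs + wipFrom M ys) ∸ M
lab-insert {M} xs ys sorted ≤M = cong₂ (λ w t → suc w ∸ t)
  (trans (wip-insert xs ys sorted (All.++⁻ˡ xs ≤M)) (+-suc (length xs) _))
  (top-≡ (xs ++ M ∷ ys) (∈-++⁺ʳ xs (here refl)) ≤M)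

insertOnce-admissible : ∀ {m M} xs ys → Admissible m (xs ++ ys) → Sorted xs → All (_< M) (xs ++ ys) →
                        M ≤ length xs → Admissible (suc m) (xs ++ M ∷ ys)
insertOnce-admissible {M = M} xs ys (inv , avoids , ≤2 , dist≡m) sorted <M M≤ =
  IsInversionFrom-insert 0 M xs ys inv M≤ ,
  Avoids102-insert M xs ys avoids sorted (All.map <⇒≤ <M) ,
  AtMostTwice-resp-↭ (↭-sym (shift M xs ys)) (AtMostTwice-∷ e ≤2 (subst (_≤ 1) (sym (occ-∉ e M∉)) z≤n)) ,
  trans (dist-↭ (shift M xs ys)) (trans (dist-∷-∉ e M∉) (cong suc dist≡m))
  where
  e  = xs ++ ys
  M∉ = <-∉ e <M

insertTwice-admissible : ∀ {m M} xs zs ws → Admissible m (xs ++ zs ++ ws) → Sorted (xs ++ zs) →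
                         All (_< M) (xs ++ zs ++ ws) → M ≤ length xs → Admissible (suc m) (xs ++ M ∷ zs ++ M ∷ ws)
insertTwice-admissible {M = M} xs zs ws (inv , avoids , ≤2 , dist≡m) sorted <M M≤ =
  IsInversionFrom-insert 0 M xs (zs ++ M ∷ ws) (subst (IsInversionFrom 0) reassoc inv′) M≤ ,
  Avoids102-insert M xs (zs ++ M ∷ ws) (subst Avoids102 reassoc avoids′) (Sorted-++⁻ˡ xs sorted)
    (subst (All (_≤ M)) reassoc (All≤-insert (xs ++ zs) ws <M′)) ,
  AtMostTwice-resp-↭ (↭-sym (insert₂-↭ M xs zs ws)) (AtMostTwice-∷ (M ∷ e) (AtMostTwice-∷ e ≤2 occ≤1) occ≤1′) ,
  trans (dist-↭ (insert₂-↭ M xs zs ws))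
        (trans (dist-∷-∈ (M ∷ e) (here refl)) (trans (dist-∷-∉ e M∉) (cong suc dist≡m)))
  where
  e = xs ++ zs ++ ws
  reassoc = ++-assoc xs zs (M ∷ ws)
  unassoc = sym (++-assoc xs zs ws)
  <M′ = subst (All (_< M)) unassoc <M
  M≤|xs++zs| = ≤-trans M≤ (≤-trans (m≤m+n (length xs) (length zs)) (≤-reflexive (sym (length-++ xs))))
  inv′    = IsInversionFrom-insert 0 M (xs ++ zs) ws (subst (IsInversionFrom 0) unassoc inv) M≤|xs++zs|
  avoids′ = Avoids102-insert M (xs ++ zs) ws (subst Avoids102 unassoc avoids) sorted (All.map <⇒≤ <M′)
  M∉ = <-∉ e <M
  occ≤1 : occ M e ≤ 1
  occ≤1 = subst (_≤ 1) (sym (occ-∉ e M∉)) z≤n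
  occ≤1′ : occ M (M ∷ e) ≤ 1
  occ≤1′ = subst (_≤ 1) (sym (trans (occ-self M e) (cong suc (occ-∉ e M∉)))) ≤-refl

Insertion-admissible : ∀ {m e M q k E} → Admissible m e → top e ≤ M → M ≤ q → q + gap k ≤ wip e →
                       Insertion e M q k E → Admissible (suc m) E × lab E ≡ suc (q + adjacencyBonus k) ∸ M
Insertion-admissible {M = M} adm t≤M M≤q q≤wip (once xs ys refl refl refl) =
  insertOnce-admissible xs ys adm sorted <M M≤q ,
  trans (lab-insert xs ys sorted (All≤-insert xs ys <M))
        (cong (λ w → suc (length xs + w) ∸ M) (wipFrom-All< ys (All.++⁻ʳ xs <M)))
  where
  <M     = top≤⇒All< (xs ++ ys) t≤M
  sorted = proj₂ (≤wipFrom⇒sorted xs ys (subst (_≤ wip (xs ++ ys)) (+-identityʳ _) q≤wip))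
Insertion-admissible {M = M} adm t≤M M≤q q+v≤wip (twice xs zs ws refl refl refl) =
  insertTwice-admissible xs zs ws adm sorted <M M≤q ,
  trans (lab-insert xs (zs ++ M ∷ ws) (Sorted-++⁻ˡ xs sorted) (All≤-insert₂ xs zs ws <M))
        (cong (λ w → suc (length xs + w) ∸ M) (wipFrom-gap zs (All.++⁻ʳ xs <M)))
  where
  <M     = top≤⇒All< (xs ++ zs ++ ws) t≤M
  sorted = proj₂ (≤wipFrom⇒sorted (xs ++ zs) ws
                    (subst₂ (λ n l → n ≤ wip l) (sym (length-++ xs)) (sym (++-assoc xs zs ws)) q+v≤wip))
  wipFrom-gap : ∀ zs′ → All (_< M) (zs′ ++ ws) → wipFrom M (zs′ ++ M ∷ ws) ≡ adjacencyBonus (just (length zs′))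
  wipFrom-gap []        <M′       = trans (wipFrom-self M ws) (cong suc (wipFrom-All< ws <M′))
  wipFrom-gap (z ∷ zs′) (z<M ∷ _) = wipFrom-< (zs′ ++ M ∷ ws) z<M

insertAt : ℕ → ℕ → List ℕ → List ℕ
insertAt q M e = take q e ++ M ∷ drop q e

insert : Maybe ℕ → ℕ → ℕ → List ℕ → List ℕ
insert nothing  q M e = insertAt q M e
insert (just v) q M e = insertAt q M (insertAt (q + v) M e)

insertAt-++ : ∀ M xs ys → insertAt (length xs) M (xs ++ ys) ≡ xs ++ M ∷ ys
insertAt-++ M []       ys = refl
insertAt-++ M (x ∷ xs) ys = cong (x ∷_) (insertAt-++ M xs ys)

insertAt-shift : ∀ M xs k ys → insertAt (length xs + k) M (xs ++ ys) ≡ xs ++ insertAt k M ys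
insertAt-shift M []       k ys = refl
insertAt-shift M (x ∷ xs) k ys = cong (x ∷_) (insertAt-shift M xs k ys)

Insertion⇒insert : ∀ {e M q k E} → Insertion e M q k E → insert k q M e ≡ E
Insertion⇒insert {M = M} (once xs ys refl refl refl) = insertAt-++ M xs ys
Insertion⇒insert {M = M} (twice xs zs ws refl refl refl) = begin
  insertAt (length xs) M (insertAt (length xs + length zs) M (xs ++ zs ++ ws))
    ≡⟨ cong (insertAt (length xs) M) (insertAt-shift M xs (length zs) (zs ++ ws)) ⟩
  insertAt (length xs) M (xs ++ insertAt (length zs) M (zs ++ ws))
    ≡⟨ cong (λ l → insertAt (length xs) M (xs ++ l)) (insertAt-++ M zs ws) ⟩
  insertAt (length xs) M (xs ++ zs ++ M ∷ ws)
    ≡⟨ insertAt-++ M xs (zs ++ M ∷ ws) ⟩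
  xs ++ M ∷ zs ++ M ∷ ws ∎
  where open ≡-Reasoning

prefixOfLength : ∀ q (e : List ℕ) → q ≤ length e →
                 Σ (List ℕ) λ xs → Σ (List ℕ) λ ys → e ≡ xs ++ ys × length xs ≡ q
prefixOfLength q e q≤ = take q e , drop q e , sym (take++drop≡id q e) , trans (length-take q e) (m≤n⇒m⊓n≡m q≤)

insert-Insertion : ∀ k q M e → q + gap k ≤ length e → Insertion e M q k (insert k q M e)
insert-Insertion nothing q M e q≤ with prefixOfLength q e (subst (_≤ length e) (+-identityʳ q) q≤)
... | xs , ys , refl , refl = once xs ys refl (insertAt-++ M xs ys) refl
insert-Insertion (just v) q M e q+v≤ with prefixOfLength q e (≤-trans (m≤m+n q v) q+v≤)
... | xs , rest , refl , refl
  with prefixOfLength v rest (+-cancelˡ-≤ (length xs) v _ (subst (length xs + v ≤_) (length-++ xs) q+v≤))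
... | zs , ws , refl , refl = twice xs zs ws refl (Insertion⇒insert (twice xs zs ws refl refl refl)) refl

record Decomposition (m : ℕ) (E : List ℕ) : Set where
  field
    {parent}   : List ℕ
    {M q}      : ℕ
    {k}        : Maybe ℕ
    admissible : Admissible m parent
    top≤M      : top parent ≤ M
    M≤q        : M ≤ q
    q+gap≤wip  : q + gap k ≤ wip parent
    insertion  : Insertion parent M q k E

decomposeOnce : ∀ {m M} xs ys → Admissible (suc m) (xs ++ M ∷ ys) → All (_≤ M) (xs ++ M ∷ ys) →
                M ∉ xs → M ∉ ys → Decomposition m (xs ++ M ∷ ys)
decomposeOnce {M = M} xs ys (inv , avoids , ≤2 , dist≡) ≤M M∉xs M∉ys = record
  { admissible = IsInversionFrom-delete 0 M xs ys inv (All.++⁻ʳ xs <M) , Avoids102-delete xs M ys avoids ,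
                 AtMostTwice-tail e (AtMostTwice-resp-↭ (shift M xs ys) ≤2) ,
                 suc-injective (trans (sym (trans (dist-↭ (shift M xs ys)) (dist-∷-∉ e M∉))) dist≡)
  ; top≤M      = top-≤ e <M
  ; M≤q        = IsInversionFrom-position 0 M xs ys inv
  ; q+gap≤wip  = subst (_≤ wip e) (sym (+-identityʳ _)) (sorted⇒≤wipFrom xs ys (All.tabulate (λ _ → z≤n)) sorted)
  ; insertion  = once xs ys refl refl refl
  }
  where
  e = xs ++ ys
  M∉ : M ∉ e
  M∉ M∈ with ∈-++⁻ xs M∈
  ... | inj₁ M∈xs = M∉xs M∈xs
  ... | inj₂ M∈ys = M∉ys M∈ys
  <M     = ≤∧∉⇒< e (All.tail (All-resp-↭ (shift M xs ys) ≤M)) M∉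
  sorted = Avoids102⇒Sorted M xs ys avoids (All.++⁻ˡ xs <M)

-- Since M occurs at most twice, the remaining entries are all smaller than M.
decomposeTwice : ∀ {m M} xs zs ws → Admissible (suc m) (xs ++ M ∷ zs ++ M ∷ ws) →
                 All (_≤ M) (xs ++ M ∷ zs ++ M ∷ ws) → Decomposition m (xs ++ M ∷ zs ++ M ∷ ws)
decomposeTwice {M = M} xs zs ws (inv , avoids , ≤2 , dist≡) ≤M = record
  { admissible = IsInversionFrom-delete 0 M xs (zs ++ ws) (subst (IsInversionFrom 0) (++-assoc xs (M ∷ zs) ws) inv′)
                                        (All.++⁻ʳ xs <M) ,
                 Avoids102-delete xs M (zs ++ ws) (subst Avoids102 (++-assoc xs (M ∷ zs) ws) avoids′) ,
                 AtMostTwice-tail e (AtMostTwice-tail (M ∷ e) ≤2′) ,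
                 suc-injective (trans (sym dist≡suc) dist≡)
  ; top≤M      = top-≤ e <M
  ; M≤q        = IsInversionFrom-position 0 M xs (zs ++ M ∷ ws) inv
  ; q+gap≤wip  = subst₂ (λ n l → n ≤ wip l) (length-++ xs) (++-assoc xs zs ws)
                   (sorted⇒≤wipFrom (xs ++ zs) ws (All.tabulate (λ _ → z≤n)) sorted)
  ; insertion  = twice xs zs ws refl refl refl
  }
  where
  e = xs ++ zs ++ ws
  split₂ : xs ++ M ∷ zs ++ M ∷ ws ≡ (xs ++ M ∷ zs) ++ M ∷ ws
  split₂ = sym (++-assoc xs (M ∷ zs) (M ∷ ws))
  ≤2′ = AtMostTwice-resp-↭ (insert₂-↭ M xs zs ws) ≤2
  M∉ : M ∉ e
  M∉ M∈ = <⇒≱ (s≤s (s≤s (∈⇒occ≥1 e M∈))) (subst (_≤ 2) (trans (occ-self M (M ∷ e)) (cong suc (occ-self M e))) (≤2′ M))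
  <M = ≤∧∉⇒< e (All.tail (All.tail (All-resp-↭ (insert₂-↭ M xs zs ws) ≤M))) M∉
  inv′    = IsInversionFrom-delete 0 M (xs ++ M ∷ zs) ws (subst (IsInversionFrom 0) split₂ inv)
                                   (All.++⁻ʳ zs (All.++⁻ʳ xs <M))
  avoids′ = Avoids102-delete (xs ++ M ∷ zs) M ws (subst Avoids102 split₂ avoids)
  dist≡suc : dist (xs ++ M ∷ zs ++ M ∷ ws) ≡ suc (dist e)
  dist≡suc = trans (dist-↭ (insert₂-↭ M xs zs ws)) (trans (dist-∷-∈ (M ∷ e) (here refl)) (dist-∷-∉ e M∉))
  sorted : Sorted (xs ++ zs)
  sorted = Avoids102⇒Sorted M (xs ++ zs) ws
    (subst Avoids102 (sym (++-assoc xs zs (M ∷ ws))) (Avoids102-delete xs M (zs ++ M ∷ ws) avoids))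
    (All.++⁻ˡ (xs ++ zs) (subst (All (_< M)) (sym (++-assoc xs zs ws)) <M))

decomposeAt : ∀ {m M} xs ys → Admissible (suc m) (xs ++ M ∷ ys) → All (_≤ M) (xs ++ M ∷ ys) → M ∉ xs →
              Decomposition m (xs ++ M ∷ ys)
decomposeAt {M = M} xs ys adm ≤M M∉xs with M ∈? ys
... | no  M∉ys = decomposeOnce xs ys adm ≤M M∉xs M∉ys
... | yes M∈ys with firstSplit ys M∈ys
... | zs , ws , refl , _ = decomposeTwice xs zs ws adm ≤M

decompose : ∀ {m} E → Admissible (suc m) E → Decomposition m E
decompose []      (_ , _ , _ , ())
decompose (x ∷ e) adm with maximum x e
... | M , M∈ , ≤M with firstSplit (x ∷ e) M∈
... | xs , ys , E≡ , M∉xs = subst (Decomposition _) (sym E≡)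
  (decomposeAt xs ys (subst (Admissible _) E≡ adm) (subst (All (_≤ M)) E≡ ≤M) M∉xs)

Insertion-top : ∀ {e M q k E} → Insertion e M q k E → All (_< M) e → top E ≡ suc M
Insertion-top (once xs ys refl refl _) <M =
  top-≡ (xs ++ _ ∷ ys) (∈-++⁺ʳ xs (here refl)) (All≤-insert xs ys <M)
Insertion-top (twice xs zs ws refl refl _) <M =
  top-≡ (xs ++ _ ∷ zs ++ _ ∷ ws) (∈-++⁺ʳ xs (here refl)) (All≤-insert₂ xs zs ws <M)

All<⇒∉ˡ : ∀ {M} xs {ys} → All (_< M) (xs ++ ys) → M ∉ xs
All<⇒∉ˡ xs <M = <-∉ xs (All.++⁻ˡ xs <M)

Insertion-unique : ∀ {e₁ e₂ M₁ M₂ q₁ q₂ k₁ k₂ E} → Insertion e₁ M₁ q₁ k₁ E → Insertion e₂ M₂ q₂ k₂ E →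
                   All (_< M₁) e₁ → All (_< M₂) e₂ → e₁ ≡ e₂ × M₁ ≡ M₂ × q₁ ≡ q₂ × k₁ ≡ k₂
Insertion-unique ins₁ ins₂ <M₁ <M₂ with suc-injective (trans (sym (Insertion-top ins₁ <M₁)) (Insertion-top ins₂ <M₂))
Insertion-unique (once xs ys refl refl refl) (once xs′ ys′ refl E≡ refl) <M₁ <M₂ | refl
  with refl , refl ← firstSplit-unique xs ys xs′ ys′ (All<⇒∉ˡ xs <M₁) (All<⇒∉ˡ xs′ <M₂) E≡
  = refl , refl , refl , refl
Insertion-unique (once xs ys refl refl refl) (twice xs′ zs′ ws′ refl E≡ refl) <M₁ <M₂ | refl
  with refl , refl ← firstSplit-unique xs ys xs′ (zs′ ++ _ ∷ ws′) (All<⇒∉ˡ xs <M₁) (All<⇒∉ˡ xs′ <M₂) E≡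
  = contradiction (∈-++⁺ʳ xs (∈-++⁺ʳ zs′ (here refl))) (<-∉ (xs ++ zs′ ++ _ ∷ ws′) <M₁)
Insertion-unique (twice xs zs ws refl refl refl) (once xs′ ys′ refl E≡ refl) <M₁ <M₂ | refl
  with refl , refl ← firstSplit-unique xs (zs ++ _ ∷ ws) xs′ ys′ (All<⇒∉ˡ xs <M₁) (All<⇒∉ˡ xs′ <M₂) E≡
  = contradiction (∈-++⁺ʳ xs (∈-++⁺ʳ zs (here refl))) (<-∉ (xs ++ zs ++ _ ∷ ws) <M₂)
Insertion-unique (twice xs zs ws refl refl refl) (twice xs′ zs′ ws′ refl E≡ refl) <M₁ <M₂ | refl
  with refl , rest≡ ← firstSplit-unique xs (zs ++ _ ∷ ws) xs′ (zs′ ++ _ ∷ ws′) (All<⇒∉ˡ xs <M₁) (All<⇒∉ˡ xs′ <M₂) E≡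
  with refl , refl ← firstSplit-unique zs ws zs′ ws′ (All<⇒∉ˡ zs (All.++⁻ʳ xs <M₁)) (All<⇒∉ˡ zs′ (All.++⁻ʳ xs <M₂))
                                       rest≡
  = refl , refl , refl , refl

ValidCode : ℕ → Code → Set
ValidCode ℓ (apart s u a)  = 1 ≤ a × a ≤ u × u ≤ s × s ≤ ℓ
ValidCode ℓ (adjacent u a) = 1 ≤ a × a ≤ u × u ≤ ℓ

∈-downTo1⁻ : ∀ {x n} → x ∈ downTo1 n → 1 ≤ x × x ≤ n
∈-downTo1⁻ x∈ with ∈-applyDownFrom⁻ suc x∈
... | i , i<n , refl = s≤s z≤n , i<n

∈-downTo1⁺ : ∀ {x n} → 1 ≤ x → x ≤ n → x ∈ downTo1 n
∈-downTo1⁺ {suc x} _ x<n = ∈-applyDownFrom⁺ suc x<n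

downTo1-Unique : ∀ n → Unique (downTo1 n)
downTo1-Unique n = Unique.applyDownFrom⁺₁ suc n (λ j<i _ 1+i≡1+j → <⇒≢ j<i (sym (suc-injective 1+i≡1+j)))

∈-codes⁻ : ∀ {ℓ c} → c ∈ codes ℓ → ValidCode ℓ c
∈-codes⁻ {ℓ} c∈ with ∈-++⁻ (apartCodes ℓ) c∈
... | inj₁ c∈apart
  with s , s∈ , c∈s ← find (∈-concatMap⁻ _ {xs = downTo1 ℓ} c∈apart)
  with u , u∈ , c∈u ← find (∈-concatMap⁻ _ {xs = downTo1 s} c∈s)
  with a , a∈ , refl ← ∈-map⁻ (apart s u) c∈u
  = proj₁ (∈-downTo1⁻ a∈) , proj₂ (∈-downTo1⁻ a∈) , proj₂ (∈-downTo1⁻ u∈) , proj₂ (∈-downTo1⁻ s∈)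
... | inj₂ c∈adjacent
  with u , u∈ , c∈u ← find (∈-concatMap⁻ _ {xs = downTo1 ℓ} c∈adjacent)
  with a , a∈ , refl ← ∈-map⁻ (adjacent u) c∈u
  = proj₁ (∈-downTo1⁻ a∈) , proj₂ (∈-downTo1⁻ a∈) , proj₂ (∈-downTo1⁻ u∈)

∈-codes⁺ : ∀ {ℓ} c → ValidCode ℓ c → c ∈ codes ℓ
∈-codes⁺ {ℓ} (apart s u a) (1≤a , a≤u , u≤s , s≤ℓ) = ∈-++⁺ˡ
  (∈-concatMap⁺ _ (lose (∈-downTo1⁺ 1≤s s≤ℓ)
    (∈-concatMap⁺ _ (lose (∈-downTo1⁺ 1≤u u≤s) (∈-map⁺ (apart s u) (∈-downTo1⁺ 1≤a a≤u))))))
  where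
  1≤u = ≤-trans 1≤a a≤u
  1≤s = ≤-trans 1≤u u≤s
∈-codes⁺ {ℓ} (adjacent u a) (1≤a , a≤u , u≤ℓ) = ∈-++⁺ʳ (apartCodes ℓ)
  (∈-concatMap⁺ _ (lose (∈-downTo1⁺ (≤-trans 1≤a a≤u) u≤ℓ) (∈-map⁺ (adjacent u) (∈-downTo1⁺ 1≤a a≤u))))

codes-Unique : ∀ ℓ → Unique (codes ℓ)
codes-Unique ℓ = Unique.++⁺ apartCodes-Unique adjacentCodes-Unique apart≢adjacent
  where
  separatedBy : ∀ {f : ℕ → List Code} (g : Code → ℕ) → (∀ {x z} → z ∈ f x → g z ≡ x) →
                ∀ {x y z} → z ∈ f x → z ∈ f y → x ≡ y
  separatedBy g g-inverts z∈fx z∈fy = trans (sym (g-inverts z∈fx)) (g-inverts z∈fy)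
  sOf uOf : Code → ℕ
  sOf (apart s _ _)  = s
  sOf (adjacent _ _) = 0
  uOf (apart _ u _) = u
  uOf (adjacent u _) = u
  apart-injective : ∀ {s u a a′} → apart s u a ≡ apart s u a′ → a ≡ a′
  apart-injective refl = refl
  adjacent-injective : ∀ {u a a′} → adjacent u a ≡ adjacent u a′ → a ≡ a′
  adjacent-injective refl = refl
  uOf-map : ∀ {s u z} → z ∈ map (apart s u) (downTo1 u) → uOf z ≡ u
  uOf-map z∈ with _ , _ , refl ← ∈-map⁻ _ z∈ = refl
  uOf-map′ : ∀ {u z} → z ∈ map (adjacent u) (downTo1 u) → uOf z ≡ u
  uOf-map′ z∈ with _ , _ , refl ← ∈-map⁻ _ z∈ = refl
  sOf-concatMap : ∀ {s z} → z ∈ concatMap (λ u → map (apart s u) (downTo1 u)) (downTo1 s) → sOf z ≡ s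
  sOf-concatMap {s} z∈
    with _ , _ , z∈u ← find (∈-concatMap⁻ _ {xs = downTo1 s} z∈)
    with _ , _ , refl ← ∈-map⁻ _ z∈u
    = refl
  apartCodes-Unique : Unique (apartCodes ℓ)
  apartCodes-Unique = concatMap-Unique _
    (λ s → concatMap-Unique _ (λ u → Unique.map⁺ apart-injective (downTo1-Unique u))
                              (separatedBy uOf uOf-map) (downTo1-Unique s))
    (separatedBy sOf sOf-concatMap) (downTo1-Unique ℓ)
  adjacentCodes-Unique : Unique (adjacentCodes ℓ)
  adjacentCodes-Unique = concatMap-Unique _ (λ u → Unique.map⁺ adjacent-injective (downTo1-Unique u))
                                            (separatedBy uOf uOf-map′) (downTo1-Unique ℓ)
  apart≢adjacent : ∀ {z} → ¬ (z ∈ apartCodes ℓ × z ∈ adjacentCodes ℓ)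
  apart≢adjacent (z∈apart , z∈adjacent)
    with s , _ , z∈s ← find (∈-concatMap⁻ _ {xs = downTo1 ℓ} z∈apart)
    with _ , _ , z∈u ← find (∈-concatMap⁻ _ {xs = downTo1 s} z∈s)
    with _ , _ , refl ← ∈-map⁻ _ z∈u
    with _ , _ , z∈u′ ← find (∈-concatMap⁻ _ {xs = downTo1 ℓ} z∈adjacent)
    with _ , _ , ()  ← ∈-map⁻ _ z∈u′

gapKind : ℕ → Maybe ℕ
gapKind zero    = nothing
gapKind (suc v) = just (suc v)

codeU codeA : Code → ℕ
codeU (apart _ u _)  = u
codeU (adjacent u _) = u
codeA (apart _ _ a)  = a
codeA (adjacent _ a) = a

-- Below a parent with top t and label ℓ, apart s u a inserts the value t + u − a at position
-- t + u − 1 and, if s < ℓ, a second copy ℓ − s entries further on; adjacent u a inserts two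
-- adjacent copies there.
position value : ℕ → Code → ℕ
position t c = t + (codeU c ∸ 1)
value    t c = t + (codeU c ∸ codeA c)

kind : ℕ → Code → Maybe ℕ
kind ℓ (apart s _ _)  = gapKind (ℓ ∸ s)
kind ℓ (adjacent _ _) = just 0

gap-gapKind : ∀ v → gap (gapKind v) ≡ v
gap-gapKind zero    = refl
gap-gapKind (suc v) = refl

adjacencyBonus-gapKind : ∀ v → adjacencyBonus (gapKind v) ≡ 0
adjacencyBonus-gapKind zero    = refl
adjacencyBonus-gapKind (suc v) = refl

suc[t+[u∸1]+x]∸[t+[u∸a]]≡a+x : ∀ t x {u a} → 1 ≤ a → a ≤ u →
                                suc (t + (u ∸ 1) + x) ∸ (t + (u ∸ a)) ≡ a + x
suc[t+[u∸1]+x]∸[t+[u∸a]]≡a+x t x {suc u} {suc a} _ (s≤s a≤u) = begin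
  suc (t + u + x) ∸ (t + (u ∸ a))
    ≡⟨ cong (_∸ (t + (u ∸ a))) (trans (cong suc (+-assoc t u x)) (sym (+-suc t (u + x)))) ⟩
  t + suc (u + x) ∸ (t + (u ∸ a))
    ≡⟨ [m+n]∸[m+o]≡n∸o t (suc (u + x)) (u ∸ a) ⟩
  suc u + x ∸ (u ∸ a)
    ≡⟨ +-∸-comm x (≤-trans (m∸n≤m u a) (n≤1+n u)) ⟩
  suc u ∸ (u ∸ a) + x
    ≡⟨ cong (_+ x) (+-∸-assoc 1 (m∸n≤m u a)) ⟩
  suc (u ∸ (u ∸ a)) + x
    ≡⟨ cong (λ b → suc b + x) (m∸[m∸n]≡n a≤u) ⟩
  suc a + x ∎
  where open ≡-Reasoning

t+[u∸1]+[ℓ∸s]≤r : ∀ {t u s ℓ r} → 1 ≤ u → u ≤ s → s ≤ ℓ → t + ℓ ≡ suc r → t + (u ∸ 1) + (ℓ ∸ s) ≤ r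
t+[u∸1]+[ℓ∸s]≤r {t} {suc u} {s} {ℓ} {r} _ u<s s≤ℓ t+ℓ≡ = ≤-pred (begin
  suc (t + u + (ℓ ∸ s))     ≡⟨ cong (_+ (ℓ ∸ s)) (+-suc t u) ⟨
  t + suc u + (ℓ ∸ s)       ≤⟨ +-monoˡ-≤ (ℓ ∸ s) (+-monoʳ-≤ t u<s) ⟩
  t + s + (ℓ ∸ s)           ≡⟨ +-assoc t s (ℓ ∸ s) ⟩
  t + (s + (ℓ ∸ s))         ≡⟨ cong (t +_) (m+[n∸m]≡n s≤ℓ) ⟩
  t + ℓ                     ≡⟨ t+ℓ≡ ⟩
  suc r                     ∎)
  where open ≤-Reasoning

code-insertion : ∀ {t r ℓ} c → t + ℓ ≡ suc r → ValidCode ℓ c →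
                 t ≤ value t c × value t c ≤ position t c × position t c + gap (kind ℓ c) ≤ r ×
                 suc (position t c + adjacencyBonus (kind ℓ c)) ∸ value t c ≡ codeLabel c
code-insertion {t} {r} {ℓ} (apart s u a) t+ℓ≡ (1≤a , a≤u , u≤s , s≤ℓ) =
  m≤m+n t _ , +-monoʳ-≤ t (∸-monoʳ-≤ u 1≤a) ,
  subst (λ v → t + (u ∸ 1) + v ≤ r) (sym (gap-gapKind (ℓ ∸ s))) (t+[u∸1]+[ℓ∸s]≤r (≤-trans 1≤a a≤u) u≤s s≤ℓ t+ℓ≡) ,
  trans (cong (λ x → suc (t + (u ∸ 1) + x) ∸ (t + (u ∸ a))) (adjacencyBonus-gapKind (ℓ ∸ s)))
        (trans (suc[t+[u∸1]+x]∸[t+[u∸a]]≡a+x t 0 1≤a a≤u) (+-identityʳ a))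
code-insertion {t} {r} {ℓ} (adjacent u a) t+ℓ≡ (1≤a , a≤u , u≤ℓ) =
  m≤m+n t _ , +-monoʳ-≤ t (∸-monoʳ-≤ u 1≤a) ,
  subst (λ v → t + (u ∸ 1) + v ≤ r) (n∸n≡0 ℓ) (t+[u∸1]+[ℓ∸s]≤r (≤-trans 1≤a a≤u) u≤ℓ ≤-refl t+ℓ≡) ,
  trans (suc[t+[u∸1]+x]∸[t+[u∸a]]≡a+x t 1 1≤a a≤u) (+-comm a 1)

t+[1+[i+j]+v]≡1+[t+i+j+v] : ∀ t i j v → t + (suc (i + j) + v) ≡ suc (t + i + j + v)
t+[1+[i+j]+v]≡1+[t+i+j+v] = solve-∀

module _ {t r ℓ : ℕ} (t+ℓ≡ : t + ℓ ≡ suc r) (i j : ℕ) where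

  private
    u a : ℕ
    u = suc (i + j)
    a = suc j

    a≤u : a ≤ u
    a≤u = s≤s (m≤n+m j i)

    position≡ : t + (u ∸ 1) ≡ t + i + j
    position≡ = sym (+-assoc t i j)

    value≡ : t + (u ∸ a) ≡ t + i
    value≡ = cong (t +_) (m+n∸n≡m i j)

    u+v≤ℓ : ∀ v → t + i + j + v ≤ r → u + v ≤ ℓ
    u+v≤ℓ v q+v≤r = +-cancelˡ-≤ t _ _ (begin
      t + (u + v)           ≡⟨ t+[1+[i+j]+v]≡1+[t+i+j+v] t i j v ⟩
      suc (t + i + j + v)   ≤⟨ s≤s q+v≤r ⟩
      suc r                 ≡⟨ t+ℓ≡ ⟨
      t + ℓ                 ∎)
      where open ≤-Reasoning

    u≤ℓ∸v : ∀ v → t + i + j + v ≤ r → u ≤ ℓ ∸ v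
    u≤ℓ∸v v q+v≤r = m+n≤o⇒m≤o∸n u (u+v≤ℓ v q+v≤r)

  code-from-offsets : ∀ k → t + i + j + gap k ≤ r →
                      Σ Code λ c → ValidCode ℓ c × position t c ≡ t + i + j × value t c ≡ t + i × kind ℓ c ≡ k
  code-from-offsets nothing        q≤r   =
    apart ℓ u a , (s≤s z≤n , a≤u , u≤ℓ∸v 0 q≤r , ≤-refl) , position≡ , value≡ , cong gapKind (n∸n≡0 ℓ)
  code-from-offsets (just zero)    q≤r   =
    adjacent u a , (s≤s z≤n , a≤u , u≤ℓ∸v 0 q≤r) , position≡ , value≡ , refl
  code-from-offsets (just (suc v)) q+v≤r =
    apart (ℓ ∸ suc v) u a , (s≤s z≤n , a≤u , u≤ℓ∸v (suc v) q+v≤r , m∸n≤m ℓ (suc v)) , position≡ , value≡ ,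
    cong gapKind (m∸[m∸n]≡n (≤-trans (m≤n+m (suc v) u) (u+v≤ℓ (suc v) q+v≤r)))

code-surjective : ∀ {t r ℓ M q} k → t + ℓ ≡ suc r → t ≤ M → M ≤ q → q + gap k ≤ r →
                  Σ Code λ c → ValidCode ℓ c × position t c ≡ q × value t c ≡ M × kind ℓ c ≡ k
code-surjective k t+ℓ≡ t≤M M≤q q+v≤r
  with i , refl ← m≤n⇒∃[o]m+o≡n t≤M
  with j , refl ← m≤n⇒∃[o]m+o≡n M≤q
  = code-from-offsets t+ℓ≡ i j k q+v≤r

gapKind≢just0 : ∀ v → gapKind v ≢ just 0
gapKind≢just0 zero    ()
gapKind≢just0 (suc v) ()

gapKind-injective : ∀ {v w} → gapKind v ≡ gapKind w → v ≡ w
gapKind-injective {zero}  {zero}  _    = refl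
gapKind-injective {suc v} {suc w} refl = refl

offsets-injective : ∀ t {u₁ a₁ u₂ a₂} → 1 ≤ a₁ → a₁ ≤ u₁ → 1 ≤ a₂ → a₂ ≤ u₂ →
                    t + (u₁ ∸ 1) ≡ t + (u₂ ∸ 1) → t + (u₁ ∸ a₁) ≡ t + (u₂ ∸ a₂) → u₁ ≡ u₂ × a₁ ≡ a₂
offsets-injective t {suc u₁} {a₁} {suc u₂} {a₂} _ a₁≤u₁ _ a₂≤u₂ pos≡ val≡
  with refl ← +-cancelˡ-≡ t u₁ u₂ pos≡
  = refl , ∸-cancelˡ-≡ a₁≤u₁ a₂≤u₂ (+-cancelˡ-≡ t _ _ val≡)
offsets-injective t {zero}             (s≤s _) () _       _  _ _
offsets-injective t {suc _} {_} {zero} _       _  (s≤s _) () _ _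

code-injective : ∀ {t ℓ} c₁ c₂ → ValidCode ℓ c₁ → ValidCode ℓ c₂ →
                 position t c₁ ≡ position t c₂ → value t c₁ ≡ value t c₂ → kind ℓ c₁ ≡ kind ℓ c₂ → c₁ ≡ c₂
code-injective {t} (apart s₁ u₁ a₁) (apart s₂ u₂ a₂) (1≤a₁ , a₁≤u₁ , _ , s₁≤ℓ) (1≤a₂ , a₂≤u₂ , _ , s₂≤ℓ)
               pos≡ val≡ kind≡
  with refl , refl ← offsets-injective t 1≤a₁ a₁≤u₁ 1≤a₂ a₂≤u₂ pos≡ val≡
  = cong (λ s → apart s u₁ a₁) (∸-cancelˡ-≡ s₁≤ℓ s₂≤ℓ (gapKind-injective kind≡))
code-injective {t} (adjacent u₁ a₁) (adjacent u₂ a₂) (1≤a₁ , a₁≤u₁ , _) (1≤a₂ , a₂≤u₂ , _) pos≡ val≡ _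
  with refl , refl ← offsets-injective t 1≤a₁ a₁≤u₁ 1≤a₂ a₂≤u₂ pos≡ val≡
  = refl
code-injective {ℓ = ℓ} (apart s₁ _ _) (adjacent _ _) _ _ _ _ kind≡ = contradiction kind≡ (gapKind≢just0 (ℓ ∸ s₁))
code-injective {ℓ = ℓ} (adjacent _ _) (apart s₂ _ _) _ _ _ _ kind≡ = contradiction (sym kind≡) (gapKind≢just0 (ℓ ∸ s₂))

-- The generating tree

t+[1+r∸t]≡1+r : ∀ t r → 1 ≤ suc r ∸ t → t + (suc r ∸ t) ≡ suc r
t+[1+r∸t]≡1+r t r 1≤ = m+[n∸m]≡n (<⇒≤ (m∸n≢0⇒n<m {suc r} {t} (λ ≡0 → <⇒≱ 1≤ (≤-reflexive ≡0))))

ValidCode⇒1≤ℓ : ∀ {ℓ} c → ValidCode ℓ c → 1 ≤ ℓ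
ValidCode⇒1≤ℓ (apart s u a)  (1≤a , a≤u , u≤s , s≤ℓ) = ≤-trans 1≤a (≤-trans a≤u (≤-trans u≤s s≤ℓ))
ValidCode⇒1≤ℓ (adjacent u a) (1≤a , a≤u , u≤ℓ)       = ≤-trans 1≤a (≤-trans a≤u u≤ℓ)

child : List ℕ → Code → List ℕ
child e c = insert (kind (lab e) c) (position (top e) c) (value (top e) c) e

code-insertionAt : ∀ e c → ValidCode (lab e) c →
                   top e ≤ value (top e) c × value (top e) c ≤ position (top e) c ×
                   position (top e) c + gap (kind (lab e) c) ≤ wip e ×
                   suc (position (top e) c + adjacencyBonus (kind (lab e) c)) ∸ value (top e) c ≡ codeLabel c
code-insertionAt e c valid = code-insertion c (t+[1+r∸t]≡1+r (top e) (wip e) (ValidCode⇒1≤ℓ c valid)) valid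

child-Insertion : ∀ e c → ValidCode (lab e) c →
                  Insertion e (value (top e) c) (position (top e) c) (kind (lab e) c) (child e c)
child-Insertion e c valid with _ , _ , q+v≤wip , _ ← code-insertionAt e c valid =
  insert-Insertion _ _ _ e (≤-trans q+v≤wip (wipFrom≤length 0 e))

child-admissible : ∀ {m} e c → Admissible m e → c ∈ codes (lab e) →
                   Admissible (suc m) (child e c) × lab (child e c) ≡ codeLabel c
child-admissible e c adm c∈ with t≤M , M≤q , q+v≤wip , label≡ ← code-insertionAt e c (∈-codes⁻ c∈)
  with adm′ , lab≡ ← Insertion-admissible adm t≤M M≤q q+v≤wip (child-Insertion e c (∈-codes⁻ c∈))
  = adm′ , trans lab≡ label≡

child-injective : ∀ e₁ e₂ c₁ c₂ → c₁ ∈ codes (lab e₁) → c₂ ∈ codes (lab e₂) →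
                  child e₁ c₁ ≡ child e₂ c₂ → e₁ ≡ e₂ × c₁ ≡ c₂
child-injective e₁ e₂ c₁ c₂ c₁∈ c₂∈ child≡
  with t≤M₁ , _ ← code-insertionAt e₁ c₁ (∈-codes⁻ c₁∈)
  with t≤M₂ , _ ← code-insertionAt e₂ c₂ (∈-codes⁻ c₂∈)
  with refl , M≡ , q≡ , k≡ ← Insertion-unique
         (child-Insertion e₁ c₁ (∈-codes⁻ c₁∈))
         (subst (Insertion _ _ _ _) (sym child≡) (child-Insertion e₂ c₂ (∈-codes⁻ c₂∈)))
         (top≤⇒All< e₁ t≤M₁) (top≤⇒All< e₂ t≤M₂)
  = refl , code-injective c₁ c₂ (∈-codes⁻ c₁∈) (∈-codes⁻ c₂∈) q≡ M≡ k≡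

child-complete : ∀ {m} E → Admissible (suc m) E →
                 Σ (List ℕ) λ e → Admissible m e × Σ Code λ c → c ∈ codes (lab e) × child e c ≡ E
child-complete E adm =
  let open Decomposition (decompose E adm)
      t≤1+wip = ≤-trans top≤M (≤-trans M≤q (≤-trans (m≤m+n q (gap k)) (m≤n⇒m≤1+n q+gap≤wip)))
      t+ℓ≡ = m+[n∸m]≡n t≤1+wip
      (c , valid , position≡ , value≡ , kind≡) = code-surjective k t+ℓ≡ top≤M M≤q q+gap≤wip
  in parent , admissible , c , ∈-codes⁺ c valid ,
     trans (cong₂ (λ k (q , M) → insert k q M parent) kind≡ (cong₂ _,_ position≡ value≡)) (Insertion⇒insert insertion)

children : List ℕ → List (List ℕ)
children e = map (child e) (codes (lab e))

generation : ℕ → List (List ℕ)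
generation zero    = [ [] ]
generation (suc m) = concatMap children (generation m)

generation-sound : ∀ m {e} → e ∈ generation m → Admissible m e
generation-sound zero    (here refl) = tt , tt , (λ _ → z≤n) , refl
generation-sound (suc m) E∈
  with e , e∈ , E∈children ← find (∈-concatMap⁻ children {xs = generation m} E∈)
  with c , c∈ , refl ← ∈-map⁻ (child e) E∈children
  = proj₁ (child-admissible e c (generation-sound m e∈) c∈)

generation-complete : ∀ m {E} → Admissible m E → E ∈ generation m
generation-complete zero    {E} adm with refl ← dist≡0⇒[] E (proj₂ (proj₂ (proj₂ adm))) = here refl
generation-complete (suc m) {E} adm with e , adm′ , c , c∈ , refl ← child-complete E adm =
  ∈-concatMap⁺ children (lose (generation-complete m adm′) (∈-map⁺ (child e) c∈))

generation-Unique : ∀ m → Unique (generation m)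
generation-Unique zero    = [] ∷ []
generation-Unique (suc m) = concatMap-Unique children
  (λ e → map-Unique (child e) (λ c₁∈ c₂∈ child≡ → proj₂ (child-injective e e _ _ c₁∈ c₂∈ child≡))
                    (codes-Unique (lab e)))
  separated (generation-Unique m)
  where
  separated : ∀ {e₁ e₂ E} → E ∈ children e₁ → E ∈ children e₂ → e₁ ≡ e₂
  separated {e₁} {e₂} E∈₁ E∈₂
    with c₁ , c₁∈ , refl ← ∈-map⁻ (child e₁) E∈₁
    with c₂ , c₂∈ , child≡ ← ∈-map⁻ (child e₂) E∈₂
    = proj₁ (child-injective e₁ e₂ c₁ c₂ c₁∈ c₂∈ child≡)

labels-generation : ∀ m → map lab (generation m) ≡ labelsAt m
labels-generation zero    = refl
labels-generation (suc m) = begin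
  map lab (concatMap children (generation m))
    ≡⟨ map-concatMap lab children (generation m) ⟩
  concatMap (map lab ∘′ children) (generation m)
    ≡⟨ cong concat (map-cong-local (All.tabulate children-labels)) ⟩
  concatMap (childLabels ∘′ lab) (generation m)
    ≡⟨ concatMap-map childLabels lab (generation m) ⟨
  concatMap childLabels (map lab (generation m))
    ≡⟨ cong (concatMap childLabels) (labels-generation m) ⟩
  concatMap childLabels (labelsAt m) ∎
  where
  open ≡-Reasoning
  children-labels : ∀ {e} → e ∈ generation m → map lab (children e) ≡ childLabels (lab e)
  children-labels {e} e∈ = trans (sym (map-∘ (codes (lab e))))
    (map-cong-local (All.tabulate (λ c∈ → proj₂ (child-admissible e _ (generation-sound m e∈) c∈))))

length-generation : ∀ m → length (generation m) ≡ raney m 2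
length-generation m =
  trans (sym (length-map lab (generation m))) (trans (cong length (labels-generation m)) (length-labelsAt m))

corollary4p5 : (m : ℕ) → Σ (List (List ℕ)) λ L →
    Unique L × ((e : List ℕ) → (e ∈ L) ⇔ Counted m e) ×
    ((2 * m + 1) * length L ≡ (4 * m + 2) C m)
corollary4p5 m = generation m , generation-Unique m ,
  (λ e → mk⇔ (to (admissible⇔counted m e) ∘ generation-sound m)
             (generation-complete m ∘ from (admissible⇔counted m e))) ,
  trans (cong ((2 * m + 1) *_) (length-generation m)) (raney-closedForm-2 m)
  where open Equivalence
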